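{- Let $n\geq 2$ and let $B=(b_{st})_{n\times n}$ be a symmetric complex matrix ($b_{st}=b_{ts}$). For $1\leq i,j\leq n$ let $B_{[ij]}=(b^{ij}_{st})$ be the matrix with $b^{ij}_{st}=b_{st}$ if $(s,t)\neq(i,j)$ and $(s,t)\neq(j,i)$, and $b^{ij}_{st}=0$ otherwise; that is, $B_{[ij]}$ is $B$ with the entries in positions $(i,j)$ and $(j,i)$ replaced by $0$. For $i<j$ let $B^{i,j}_{i,j}$ denote the $(n-2)\times(n-2)$ submatrix of $B$ obtained by deleting rows $i,j$ and columns $i,j$. Then $$\frac{1}{2}(n^{2}-n)\,d_{2}(B)=\sum_{1\leq i\leq j\leq n}d_{2}(B_{[ij]})+\sum_{1\leq i<j\leq n}b_{ij}^{2}\,d_{2}(B^{i,j}_{i,j}).$$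
   Context: For a $k\times k$ matrix $X=(x_{st})$, the second immanant is $d_2(X)=\sum_{\sigma\in S_k}\chi_2(\sigma)\prod_{s=1}^k x_{s\sigma(s)}$, where $\chi_2$ is the irreducible character of the symmetric group $S_k$ corresponding to the partition $(2,1^{k-2})$; equivalently $\chi_2(\sigma)=\mathrm{sgn}(\sigma)(\mathrm{fix}(\sigma)-1)$, and $d_2(X)=\sum_{i=1}^k x_{ii}\det(X(i))-\det(X)$, where $X(i)$ is $X$ with row and column $i$ deleted. This last formula is taken as the definition for all $k\geq 0$, with the determinant of the empty ($0\times 0$) matrix equal to $1$ (so $d_2$ of a $1\times1$ matrix is $0$ and $d_2$ of the empty matrix is $-1$). -}

module Defs where

open import Level using (Level)
open import Data.Nat using (ℕ; zero; suc; _≤?_; _<?_)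
open import Data.Fin using (Fin; zero; suc; toℕ; punchIn; punchOut)
open import Relation.Nullary using (yes; no)
open import Relation.Binary.PropositionalEquality using (_≡_; _≢_; refl; sym)
open import Data.Product using (_×_; _,_)
open import Data.Fin.Properties using (_≟_)
open import Data.Nat.Properties using (<-irrefl)
open import Relation.Nullary using (Dec; ¬_)
open import Data.Empty using (⊥-elim)
open import Algebra.Bundles using (CommutativeRing)
import Algebra.Bundles
import Algebra.Definitions.RawSemiring as RS

-- Everything is developed over an arbitrary commutative ring R
-- (the paper works over ℂ).
module WithRing {c ℓ : Level} (R : CommutativeRing c ℓ) where
  open CommutativeRing R hiding (zero; refl; sym)

  open RS (Algebra.Bundles.Semiring.rawSemiring semiring) public using () renaming (_×_ to _·_)

  Matrix : ℕ → Set c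
  Matrix k = Fin k → Fin k → Carrier

  Σ : ∀ {k} → (Fin k → Carrier) → Carrier
  Σ {zero}  f = 0#
  Σ {suc k} f = f zero + Σ (λ i → f (suc i))

  alt : ℕ → Carrier
  alt zero    = 1#
  alt (suc m) = - alt m

  minor : ∀ {k} → Fin (suc k) → Fin (suc k) → Matrix (suc k) → Matrix k
  minor i j M s t = M (punchIn i s) (punchIn j t)

  det : ∀ k → Matrix k → Carrier
  det zero    M = 1#
  det (suc k) M = Σ (λ j → alt (toℕ j) * (M zero j * det k (minor zero j M)))

  -- second immanant: d₂(X) = Σ_i x_ii det(X(i)) − det(X); d₂ of the empty matrix is −1
  d₂ : ∀ k → Matrix k → Carrier
  d₂ zero    X = - 1#
  d₂ (suc k) X = Σ (λ i → X i i * det k (minor i i X)) - det (suc k) X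

  zeroPair : ∀ {n} → Fin n → Fin n → Matrix n → Matrix n
  zeroPair i j B s t with s ≟ i | t ≟ j | s ≟ j | t ≟ i
  ... | yes _ | yes _ | _     | _     = 0#
  ... | _     | _     | yes _ | yes _ = 0#
  ... | _     | _     | _     | _     = B s t

  -- B^{i,j}_{i,j}: delete rows i,j and columns i,j (i ≢ j);
  -- first delete row/column j, then row/column at the position of i in the reduced matrix
  deleteTwo : ∀ {n} (i j : Fin n) → i ≢ j → Matrix n → Matrix (n Data.Nat.∸ 2)
  deleteTwo {suc zero} zero zero i≢j B = ⊥-elim (i≢j refl)
  deleteTwo {suc (suc k)} i j i≢j B = minor p p (minor j j B)
    where p = punchOut (λ j≡i → i≢j (sym j≡i))

  sumLe : ∀ n → Matrix n → Carrier
  sumLe n B = Σ (λ i → Σ (λ j → term i j))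
    where
    term : Fin n → Fin n → Carrier
    term i j with toℕ i ≤? toℕ j
    ... | yes _ = d₂ n (zeroPair i j B)
    ... | no  _ = 0#

  sumLt : ∀ n → Matrix n → Carrier
  sumLt n B = Σ (λ i → Σ (λ j → term i j))
    where
    term : Fin n → Fin n → Carrier
    term i j with toℕ i <? toℕ j
    ... | yes i<j = (B i j * B i j) * d₂ (n Data.Nat.∸ 2) (deleteTwo i j (neq i<j) B)
      where
      neq : _ → i ≢ j
      neq lt refl = <-irrefl refl lt
    ... | no  _ = 0#

{-# OPTIONS --safe #-}
-- Both det and d₂ are affine in every single entry, so the effect of zeroing entries is governed by
-- the discrete partial derivatives ∂[ s , t ] F X = F (X with x_st = 1) - F (X with x_st = 0):
--   d₂(B_[ii]) = d₂ B - b_ii ∂_ii d₂ B,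
--   d₂(B_[ij]) = d₂ B - b_ij ∂_ij d₂ B - b_ji ∂_ji d₂ B + b_ij b_ji ∂_ji ∂_ij d₂ B   (i ≠ j).
-- The cofactor formula ∂_st det = ± det (minor s t) turns d₂ into Σ_q x_qq ∂_qq det - det, and since
-- derivatives in different rows commute, ∂_ji ∂_ij d₂ B = - d₂(B^{i,j}_{i,j}). Summing over i ≤ j, the
-- first-order terms add up to Σ_{s,t} b_st ∂_st d₂ B, which is n d₂ B by Euler's identity for the
-- degree-n homogeneous polynomial d₂; this leaves (binomial(n+1,2) - n) d₂ B = binomial(n,2) d₂ B.
module Submission where

open import Defs
open import Level using (Level; _⊔_)
open import Function using (_∘_)
open import Data.Nat as ℕ using (ℕ; zero; suc; s≤s; s≤s⁻¹; _≤?_; _<?_)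
import Data.Nat.Properties as ℕₚ
open import Data.Nat.Combinatorics using (_C_; nCk≡nPk/k!; nCk+nC[k+1]≡[n+1]C[k+1]; nC1≡n)
open import Data.Integer as ℤ using (ℤ; +_; -[1+_]; _⊖_; _◃_; ∣_∣)
import Data.Integer.Properties as ℤ
open import Data.Sign as Sign using (Sign)
open import Data.Fin using (Fin; zero; suc; toℕ; punchIn; punchOut)
open import Data.Fin.Properties
  using (_≟_; <-cmp; toℕ-injective; punchIn-punchOut; punchOut-punchIn; punchInᵢ≢i; punchIn-injective)
open import Data.Maybe using (Maybe; just; nothing)
open import Data.Product using (_×_; _,_)
open import Data.Sum as Sum using (_⊎_; inj₁; inj₂)
open import Relation.Nullary using (Dec; yes; no; ¬_)
open import Relation.Nullary.Negation using (contradiction)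
open import Relation.Binary.Definitions using (tri<; tri≈; tri>)
open import Relation.Binary.PropositionalEquality as ≡ using (_≡_; _≢_)
open import Algebra.Bundles using (CommutativeRing)
open import Algebra.Solver.Ring.AlmostCommutativeRing using (_-Raw-AlmostCommutative⟶_; fromCommutativeRing)

-- Algebra.Solver.Ring needs coefficients with decidable equality; ℤ maps into every commutative ring.
module RingSolver {c ℓ : Level} (R : CommutativeRing c ℓ) where
  open CommutativeRing R hiding (zero)
  open import Algebra.Properties.Ring ring using (-0#≈0#; -‿involutive; -‿distribˡ-*; -‿distribʳ-*; -‿+-comm)
  open import Algebra.Properties.AbelianGroup +-abelianGroup using (xyx⁻¹≈y)
  open import Algebra.Properties.Semiring.Mult semiring using (×-homo-+; ×1-homo-*) renaming (_×_ to _·_)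
  open import Algebra.Solver.CommutativeMonoid +-commutativeMonoid using (_⊕_; _⊜_) renaming (solve to +-solve)
  open import Relation.Binary.Reasoning.Setoid setoid

  ⟦_⟧ : ℤ → Carrier
  ⟦ + n ⟧      = n · 1#
  ⟦ -[1+ n ] ⟧ = - (suc n · 1#)

  signed : Sign → Carrier → Carrier
  signed Sign.+ x = x
  signed Sign.- x = - x

  signed-cong : ∀ s {x y} → x ≈ y → signed s x ≈ signed s y
  signed-cong Sign.+ x≈y = x≈y
  signed-cong Sign.- x≈y = -‿cong x≈y

  signed-* : ∀ s t x y → signed (s Sign.* t) (x * y) ≈ signed s x * signed t y
  signed-* Sign.+ Sign.+ x y = refl
  signed-* Sign.+ Sign.- x y = -‿distribʳ-* x y
  signed-* Sign.- Sign.+ x y = -‿distribˡ-* x y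
  signed-* Sign.- Sign.- x y = begin
    x * y         ≈⟨ -‿involutive _ ⟨
    - - (x * y)   ≈⟨ -‿cong (-‿distribˡ-* x y) ⟩
    - (- x * y)   ≈⟨ -‿distribʳ-* (- x) y ⟩
    - x * - y     ∎

  ⟦◃⟧ : ∀ s n → ⟦ s ◃ n ⟧ ≈ signed s (n · 1#)
  ⟦◃⟧ Sign.+ zero    = refl
  ⟦◃⟧ Sign.- zero    = sym -0#≈0#
  ⟦◃⟧ Sign.+ (suc n) = refl
  ⟦◃⟧ Sign.- (suc n) = refl

  ⟦⟧≈signed : ∀ i → ⟦ i ⟧ ≈ signed (ℤ.sign i) (∣ i ∣ · 1#)
  ⟦⟧≈signed (+ n)    = refl
  ⟦⟧≈signed -[1+ n ] = refl

  ⟦⊖⟧ : ∀ m n → ⟦ m ⊖ n ⟧ ≈ m · 1# - n · 1#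
  ⟦⊖⟧ zero    zero    = sym (-‿inverseʳ 0#)
  ⟦⊖⟧ zero    (suc n) = sym (+-identityˡ _)
  ⟦⊖⟧ (suc m) zero    = sym (trans (+-congˡ -0#≈0#) (+-identityʳ _))
  ⟦⊖⟧ (suc m) (suc n) = begin
    ⟦ suc m ⊖ suc n ⟧       ≡⟨ ≡.cong ⟦_⟧ (ℤ.[1+m]⊖[1+n]≡m⊖n m n) ⟩
    ⟦ m ⊖ n ⟧               ≈⟨ ⟦⊖⟧ m n ⟩
    a - b                   ≈⟨ xyx⁻¹≈y 1# (a - b) ⟨
    1# + (a - b) - 1#       ≈⟨ +-solve 4 (λ x y z w → (x ⊕ (y ⊕ w)) ⊕ z ⊜ (x ⊕ y) ⊕ (z ⊕ w)) refl
                                       1# a (- 1#) (- b) ⟩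
    (1# + a) + (- 1# - b)   ≈⟨ +-congˡ (-‿+-comm 1# b) ⟩
    (1# + a) - (1# + b)     ∎
    where a = m · 1#; b = n · 1#

  ⟦+⟧ : ∀ i j → ⟦ i ℤ.+ j ⟧ ≈ ⟦ i ⟧ + ⟦ j ⟧
  ⟦+⟧ -[1+ m ] -[1+ n ] = begin
    - (suc (suc (m ℕ.+ n)) · 1#)      ≡⟨ ≡.cong (λ k → - (k · 1#)) (ℕₚ.+-suc (suc m) n) ⟨
    - ((suc m ℕ.+ suc n) · 1#)        ≈⟨ -‿cong (×-homo-+ 1# (suc m) (suc n)) ⟩
    - (suc m · 1# + suc n · 1#)       ≈⟨ -‿+-comm _ _ ⟨
    - (suc m · 1#) + - (suc n · 1#)   ∎
  ⟦+⟧ -[1+ m ] (+ n)    = trans (⟦⊖⟧ n (suc m)) (+-comm _ _)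
  ⟦+⟧ (+ m)    -[1+ n ] = ⟦⊖⟧ m (suc n)
  ⟦+⟧ (+ m)    (+ n)    = ×-homo-+ 1# m n

  ⟦*⟧ : ∀ i j → ⟦ i ℤ.* j ⟧ ≈ ⟦ i ⟧ * ⟦ j ⟧
  ⟦*⟧ i j = begin
    ⟦ s ◃ ∣ i ∣ ℕ.* ∣ j ∣ ⟧                             ≈⟨ ⟦◃⟧ s (∣ i ∣ ℕ.* ∣ j ∣) ⟩
    signed s ((∣ i ∣ ℕ.* ∣ j ∣) · 1#)                    ≈⟨ signed-cong s (×1-homo-* ∣ i ∣ ∣ j ∣) ⟩
    signed s ((∣ i ∣ · 1#) * (∣ j ∣ · 1#))              ≈⟨ signed-* (ℤ.sign i) (ℤ.sign j) _ _ ⟩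
    signed (ℤ.sign i) (∣ i ∣ · 1#) * signed (ℤ.sign j) (∣ j ∣ · 1#)
                                                          ≈⟨ *-cong (⟦⟧≈signed i) (⟦⟧≈signed j) ⟨
    ⟦ i ⟧ * ⟦ j ⟧                                         ∎
    where s = ℤ.sign i Sign.* ℤ.sign j

  ⟦-⟧ : ∀ i → ⟦ ℤ.- i ⟧ ≈ - ⟦ i ⟧
  ⟦-⟧ (+ zero)  = sym -0#≈0#
  ⟦-⟧ (+ suc n) = refl
  ⟦-⟧ -[1+ n ]  = sym (-‿involutive _)

  homomorphism : ℤ.+-*-rawRing -Raw-AlmostCommutative⟶ fromCommutativeRing R
  homomorphism = record
    { ⟦_⟧ = ⟦_⟧ ; +-homo = ⟦+⟧ ; *-homo = ⟦*⟧ ; -‿homo = ⟦-⟧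
    ; 0-homo = refl ; 1-homo = +-identityʳ 1# }

  ⟦⟧-equal? : ∀ i j → Maybe (⟦ i ⟧ ≈ ⟦ j ⟧)
  ⟦⟧-equal? i j with i ℤ.≟ j
  ... | yes ≡.refl = just refl
  ... | no _       = nothing

  open import Algebra.Solver.Ring ℤ.+-*-rawRing (fromCommutativeRing R) homomorphism ⟦⟧-equal? public
    using (solve; _:=_; _:+_; _:-_; _:*_; :-_)

module Development {c ℓ : Level} (R : CommutativeRing c ℓ) where
  open CommutativeRing R hiding (zero)
  open WithRing R
  open RingSolver R
  open import Algebra.Properties.Ring ring
    using (-0#≈0#; -‿involutive; -‿distribˡ-*; -‿distribʳ-*; -‿+-comm; x[y-z]≈xy-xz; [y-z]x≈yx-zx)
  open import Algebra.Properties.AbelianGroup +-abelianGroup using (xyx⁻¹≈y)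
  open import Algebra.Properties.Semiring.Mult semiring using (×-homo-+; ×-assoc-*; ×-comm-*)
  open import Algebra.Properties.Semiring.Sum semiring
    using (sum; sum-cong-≋; ∑-distrib-+; ∑-comm; sum-remove; sum-replicate; sum-replicate-zero; *-distribˡ-sum)
  open import Relation.Binary.Reasoning.Setoid setoid

  private variable
    k : ℕ
    a b : Carrier
    f g : Fin k → Carrier
    s t s′ t′ u v : Fin k
    X Y Z : Matrix k
    F G : Matrix k → Carrier

  Σ≈sum : (f : Fin k → Carrier) → Σ f ≈ sum f
  Σ≈sum {zero}  f = refl
  Σ≈sum {suc k} f = +-congˡ (Σ≈sum (f ∘ suc))

  Σ-cong : (∀ i → f i ≈ g i) → Σ f ≈ Σ g
  Σ-cong {f = f} {g} f≈g = trans (Σ≈sum f) (trans (sum-cong-≋ f≈g) (sym (Σ≈sum g)))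

  Σ-distrib-+ : (f g : Fin k → Carrier) → Σ (λ i → f i + g i) ≈ Σ f + Σ g
  Σ-distrib-+ f g = begin
    Σ (λ i → f i + g i)    ≈⟨ Σ≈sum (λ i → f i + g i) ⟩
    sum (λ i → f i + g i)  ≈⟨ ∑-distrib-+ f g ⟩
    sum f + sum g          ≈⟨ +-cong (Σ≈sum f) (Σ≈sum g) ⟨
    Σ f + Σ g              ∎

  Σ-distrib-neg : (f : Fin k → Carrier) → Σ (λ i → - f i) ≈ - Σ f
  Σ-distrib-neg {zero}  f = sym -0#≈0#
  Σ-distrib-neg {suc k} f = trans (+-congˡ (Σ-distrib-neg (f ∘ suc))) (-‿+-comm _ _)

  Σ-distrib-- : (f g : Fin k → Carrier) → Σ (λ i → f i - g i) ≈ Σ f - Σ g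
  Σ-distrib-- f g = trans (Σ-distrib-+ f (λ i → - g i)) (+-congˡ (Σ-distrib-neg g))

  Σ-comm : ∀ {m} (f : Fin k → Fin m → Carrier) → Σ (λ i → Σ (f i)) ≈ Σ (λ j → Σ (λ i → f i j))
  Σ-comm f = begin
    Σ (λ i → Σ (f i))
      ≈⟨ trans (Σ≈sum (λ i → Σ (f i))) (sum-cong-≋ (λ i → Σ≈sum (f i))) ⟩
    sum (λ i → sum (f i))
      ≈⟨ ∑-comm f ⟩
    sum (λ j → sum (λ i → f i j))
      ≈⟨ trans (Σ≈sum (λ j → Σ (λ i → f i j))) (sum-cong-≋ (λ j → Σ≈sum (λ i → f i j))) ⟨
    Σ (λ j → Σ (λ i → f i j))      ∎

  Σ-remove : (i : Fin (suc k)) (f : Fin (suc k) → Carrier) → Σ f ≈ f i + Σ (f ∘ punchIn i)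
  Σ-remove i f = begin
    Σ f                        ≈⟨ Σ≈sum f ⟩
    sum f                      ≈⟨ sum-remove f ⟩
    f i + sum (f ∘ punchIn i)  ≈⟨ +-congˡ (Σ≈sum (f ∘ punchIn i)) ⟨
    f i + Σ (f ∘ punchIn i)    ∎

  Σ-const : ∀ k x → Σ {k} (λ _ → x) ≈ k · x
  Σ-const k x = trans (Σ≈sum {k} (λ _ → x)) (sum-replicate k)

  Σ-zero : ∀ {k} {f : Fin k → Carrier} → (∀ i → f i ≈ 0#) → Σ f ≈ 0#
  Σ-zero {k} f≈0 = trans (Σ-cong f≈0) (trans (Σ≈sum {k} (λ _ → 0#)) (sum-replicate-zero k))

  Σ-punchIn : (i : Fin (suc k)) (f : Fin (suc k) → Carrier) → f i ≈ 0# → Σ f ≈ Σ (f ∘ punchIn i)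
  Σ-punchIn i f fi≈0 = trans (Σ-remove i f) (trans (+-congʳ fi≈0) (+-identityˡ _))

  Σ-single : (i : Fin (suc k)) (f : Fin (suc k) → Carrier) → (∀ j → f (punchIn i j) ≈ 0#) → Σ f ≈ f i
  Σ-single i f rest≈0 = trans (Σ-remove i f) (trans (+-congˡ (Σ-zero rest≈0)) (+-identityʳ _))

  *-distribˡ-Σ : ∀ x (f : Fin k → Carrier) → x * Σ f ≈ Σ (λ i → x * f i)
  *-distribˡ-Σ x f = trans (*-congˡ (Σ≈sum f)) (trans (*-distribˡ-sum x f) (sym (Σ≈sum (λ i → x * f i))))

  *-distribʳ-Σ : ∀ x (f : Fin k → Carrier) → Σ f * x ≈ Σ (λ i → f i * x)
  *-distribʳ-Σ x f = trans (*-comm _ x) (trans (*-distribˡ-Σ x f) (Σ-cong (λ i → *-comm x (f i))))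

  ·-distrib-Σ : ∀ m (f : Fin k → Carrier) → m · Σ f ≈ Σ (λ i → m · f i)
  ·-distrib-Σ zero    f = sym (Σ-zero {f = λ i → 0 · f i} (λ _ → refl))
  ·-distrib-Σ (suc m) f = trans (+-congˡ (·-distrib-Σ m f)) (sym (Σ-distrib-+ f (λ i → m · f i)))

  ·-distrib-- : ∀ m a b → m · (a - b) ≈ m · a - m · b
  ·-distrib-- m a b = begin
    m · (a - b)                        ≈⟨ Σ-const m (a - b) ⟨
    Σ {m} (λ _ → a - b)                ≈⟨ Σ-distrib-- {k = m} (λ _ → a) (λ _ → b) ⟩
    Σ {m} (λ _ → a) - Σ {m} (λ _ → b)  ≈⟨ +-cong (Σ-const m a) (-‿cong (Σ-const m b)) ⟩
    m · a - m · b                      ∎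

  ΣΣ-cong : ∀ {k} {h h′ : Fin k → Fin k → Carrier} → (∀ s t → h s t ≈ h′ s t) →
            Σ (λ s → Σ (h s)) ≈ Σ (λ s → Σ (h′ s))
  ΣΣ-cong h≈h′ = Σ-cong (λ s → Σ-cong (h≈h′ s))

  ΣΣ-distrib-+ : (h h′ : Fin k → Fin k → Carrier) →
                 Σ (λ s → Σ (λ t → h s t + h′ s t)) ≈ Σ (λ s → Σ (h s)) + Σ (λ s → Σ (h′ s))
  ΣΣ-distrib-+ h h′ =
    trans (Σ-cong (λ s → Σ-distrib-+ (h s) (h′ s))) (Σ-distrib-+ (λ s → Σ (h s)) (λ s → Σ (h′ s)))

  ΣΣ-distrib-- : (h h′ : Fin k → Fin k → Carrier) →
                 Σ (λ s → Σ (λ t → h s t - h′ s t)) ≈ Σ (λ s → Σ (h s)) - Σ (λ s → Σ (h′ s))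
  ΣΣ-distrib-- h h′ =
    trans (Σ-cong (λ s → Σ-distrib-- (h s) (h′ s))) (Σ-distrib-- (λ s → Σ (h s)) (λ s → Σ (h′ s)))

  ΣΣ-distribˡ-* : ∀ x (h : Fin k → Fin k → Carrier) →
                  x * Σ (λ s → Σ (h s)) ≈ Σ (λ s → Σ (λ t → x * h s t))
  ΣΣ-distribˡ-* x h = trans (*-distribˡ-Σ x (λ s → Σ (h s))) (Σ-cong (λ s → *-distribˡ-Σ x (h s)))

  ΣΣ-distribʳ-* : ∀ x (h : Fin k → Fin k → Carrier) →
                  Σ (λ s → Σ (h s)) * x ≈ Σ (λ s → Σ (λ t → h s t * x))
  ΣΣ-distribʳ-* x h = trans (*-distribʳ-Σ x (λ s → Σ (h s))) (Σ-cong (λ s → *-distribʳ-Σ x (h s)))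

  alt-+ : ∀ m n → alt (m ℕ.+ n) ≈ alt m * alt n
  alt-+ zero    n = sym (*-identityˡ _)
  alt-+ (suc m) n = trans (-‿cong (alt-+ m n)) (-‿distribˡ-* _ _)

  alt-square : ∀ m → alt m * alt m ≈ 1#
  alt-square zero    = *-identityˡ 1#
  alt-square (suc m) = trans (solve 1 (λ x → :- x :* :- x := x :* x) refl (alt m)) (alt-square m)

  alt-suc-suc : ∀ m n → alt (suc m ℕ.+ suc n) ≈ alt (m ℕ.+ n)
  alt-suc-suc m n = trans (-‿cong (reflexive (≡.cong alt (ℕₚ.+-suc m n)))) (-‿involutive _)

  alt-+zero : ∀ m → alt (m ℕ.+ 0) ≈ alt m
  alt-+zero m = reflexive (≡.cong alt (ℕₚ.+-identityʳ m))

  -- Whichever of i, j is smaller, the two exponents differ by exactly one.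
  alt-punchOut : ∀ {k} {i j : Fin (suc k)} (i≢j : i ≢ j) (j≢i : j ≢ i) →
                 alt (toℕ i ℕ.+ toℕ (punchOut i≢j)) ≈ - alt (toℕ j ℕ.+ toℕ (punchOut j≢i))
  alt-punchOut {i = zero} {zero} i≢j j≢i = contradiction ≡.refl i≢j
  alt-punchOut {suc k} {i = zero} {suc j} i≢j j≢i =
    trans (sym (-‿involutive _)) (-‿cong (-‿cong (sym (alt-+zero (toℕ j)))))
  alt-punchOut {suc k} {i = suc i} {zero} i≢j j≢i = -‿cong (alt-+zero (toℕ i))
  alt-punchOut {suc k} {i = suc i} {suc j} i≢j j≢i = begin
    alt (suc (toℕ i) ℕ.+ suc (toℕ (punchOut i≢j′)))    ≈⟨ alt-suc-suc (toℕ i) _ ⟩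
    alt (toℕ i ℕ.+ toℕ (punchOut i≢j′))                ≈⟨ alt-punchOut i≢j′ j≢i′ ⟩
    - alt (toℕ j ℕ.+ toℕ (punchOut j≢i′))              ≈⟨ -‿cong (alt-suc-suc (toℕ j) _) ⟨
    - alt (suc (toℕ j) ℕ.+ suc (toℕ (punchOut j≢i′)))  ∎
    where
    i≢j′ = i≢j ∘ ≡.cong suc
    j≢i′ = j≢i ∘ ≡.cong suc

  data PunchView {k} (i : Fin (suc k)) : Fin (suc k) → Set where
    here  : PunchView i i
    there : ∀ s → PunchView i (punchIn i s)

  punchView : ∀ {k} (i s : Fin (suc k)) → PunchView i s
  punchView i s with i ≟ s
  ... | yes ≡.refl = here
  ... | no i≢s     = ≡.subst (PunchView i) (punchIn-punchOut i≢s) (there (punchOut i≢s))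

  punchIn-swap : ∀ {k} {i j : Fin (suc (suc k))} (i≢j : i ≢ j) (j≢i : j ≢ i) (s : Fin k) →
                 punchIn i (punchIn (punchOut i≢j) s) ≡ punchIn j (punchIn (punchOut j≢i) s)
  punchIn-swap {i = zero}  {zero}  i≢j j≢i s = contradiction ≡.refl i≢j
  punchIn-swap {i = zero}  {suc j} i≢j j≢i s = ≡.refl
  punchIn-swap {i = suc i} {zero}  i≢j j≢i s = ≡.refl
  punchIn-swap {suc k} {suc i} {suc j} i≢j j≢i zero    = ≡.refl
  punchIn-swap {suc k} {suc i} {suc j} i≢j j≢i (suc s) =
    ≡.cong suc (punchIn-swap (i≢j ∘ ≡.cong suc) (j≢i ∘ ≡.cong suc) s)

  infix 4 _≋_
  _≋_ : Matrix k → Matrix k → Set ℓ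
  X ≋ Y = ∀ s t → X s t ≈ Y s t

  -- _[_,_]≔_ and ∂[_,_] are opaque so that unification can recover their arguments from a goal;
  -- update-same, update-other and ∂-expand are their defining equations.
  opaque
    _[_,_]≔_ : Matrix k → Fin k → Fin k → Carrier → Matrix k
    (X [ s , t ]≔ a) u v with u ≟ s | v ≟ t
    ... | yes _ | yes _ = a
    ... | _     | _     = X u v

    update-same : (X [ s , t ]≔ a) s t ≡ a
    update-same {s = s} {t = t} with s ≟ s | t ≟ t
    ... | yes _  | yes _  = ≡.refl
    ... | no s≢s | _      = contradiction ≡.refl s≢s
    ... | yes _  | no t≢t = contradiction ≡.refl t≢t

    update-other : u ≢ s ⊎ v ≢ t → (X [ s , t ]≔ a) u v ≡ X u v
    update-other {u = u} {s = s} {v = v} {t = t} elsewhere with u ≟ s | v ≟ t | elsewhere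
    ... | yes u≡s | yes _   | inj₁ u≢s = contradiction u≡s u≢s
    ... | yes _   | yes v≡t | inj₂ v≢t = contradiction v≡t v≢t
    ... | yes _   | no _    | _        = ≡.refl
    ... | no _    | _       | _        = ≡.refl

  position? : (u v s t : Fin k) → (u ≡ s × v ≡ t) ⊎ (u ≢ s ⊎ v ≢ t)
  position? u v s t with u ≟ s | v ≟ t
  ... | yes u≡s | yes v≡t = inj₁ (u≡s , v≡t)
  ... | yes _   | no v≢t  = inj₂ (inj₂ v≢t)
  ... | no u≢s  | _       = inj₂ (inj₁ u≢s)

  update-cong-at : (u v : Fin k) → Y u v ≈ Z u v → (Y [ s , t ]≔ a) u v ≈ (Z [ s , t ]≔ a) u v
  update-cong-at {s = s} {t = t} u v Yuv≈Zuv with position? u v s t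
  ... | inj₁ (≡.refl , ≡.refl) = reflexive (≡.trans update-same (≡.sym update-same))
  ... | inj₂ elsewhere         =
    trans (reflexive (update-other elsewhere)) (trans Yuv≈Zuv (reflexive (≡.sym (update-other elsewhere))))

  update-cong : a ≈ b → X ≋ Y → X [ s , t ]≔ a ≋ Y [ s , t ]≔ b
  update-cong {s = s} {t = t} a≈b X≋Y u v with position? u v s t
  ... | inj₁ (≡.refl , ≡.refl) = trans (reflexive update-same) (trans a≈b (reflexive (≡.sym update-same)))
  ... | inj₂ elsewhere         =
    trans (reflexive (update-other elsewhere)) (trans (X≋Y u v) (reflexive (≡.sym (update-other elsewhere))))

  update-self : X [ s , t ]≔ X s t ≋ X
  update-self {s = s} {t = t} u v with position? u v s t
  ... | inj₁ (≡.refl , ≡.refl) = reflexive update-same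
  ... | inj₂ elsewhere         = reflexive (update-other elsewhere)

  update-idem : (X [ s , t ]≔ b) [ s , t ]≔ a ≋ X [ s , t ]≔ a
  update-idem {s = s} {t = t} u v with position? u v s t
  ... | inj₁ (≡.refl , ≡.refl) = reflexive (≡.trans update-same (≡.sym update-same))
  ... | inj₂ elsewhere         = reflexive (≡.trans (update-other elsewhere)
                                           (≡.trans (update-other elsewhere) (≡.sym (update-other elsewhere))))

  update-comm : s ≢ s′ → (X [ s′ , t′ ]≔ b) [ s , t ]≔ a ≋ (X [ s , t ]≔ a) [ s′ , t′ ]≔ b
  update-comm {s = s} {t = t} s≢s′ u v with position? u v s t
  ... | inj₁ (≡.refl , ≡.refl) =
    reflexive (≡.trans update-same (≡.sym (≡.trans (update-other (inj₁ s≢s′)) update-same)))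
  ... | inj₂ elsewhere         =
    trans (reflexive (update-other elsewhere)) (update-cong-at u v (reflexive (≡.sym (update-other elsewhere))))

  minor-cong : ∀ {k} (i j : Fin (suc k)) {X Y : Matrix (suc k)} → X ≋ Y → minor i j X ≋ minor i j Y
  minor-cong i j X≋Y u v = X≋Y (punchIn i u) (punchIn j v)

  minor-update : ∀ {k} (i j : Fin (suc k)) {X : Matrix (suc k)} {s t a} →
                 minor i j (X [ punchIn i s , punchIn j t ]≔ a) ≋ minor i j X [ s , t ]≔ a
  minor-update i j {s = s} {t} u v with position? u v s t
  ... | inj₁ (≡.refl , ≡.refl) = reflexive (≡.trans update-same (≡.sym update-same))
  ... | inj₂ elsewhere         = reflexive (≡.trans (update-other (Sum.map (_∘ punchIn-injective i u s)
                                                                             (_∘ punchIn-injective j v t) elsewhere))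
                                                    (≡.sym (update-other elsewhere)))

  minor-update-row : ∀ {k} (i j : Fin (suc k)) {X : Matrix (suc k)} {t a} →
                     minor i j (X [ i , t ]≔ a) ≋ minor i j X
  minor-update-row i j u v = reflexive (update-other (inj₁ (punchInᵢ≢i i u)))

  minor-update-col : ∀ {k} (i j : Fin (suc k)) {X : Matrix (suc k)} {s a} →
                     minor i j (X [ s , j ]≔ a) ≋ minor i j X
  minor-update-col i j u v = reflexive (update-other (inj₂ (punchInᵢ≢i j v)))

  zeroPair≋update : ∀ {n} (i j : Fin n) (B : Matrix n) → zeroPair i j B ≋ (B [ j , i ]≔ 0#) [ i , j ]≔ 0#
  zeroPair≋update i j B u v with u ≟ i | v ≟ j | u ≟ j | v ≟ i
  ... | yes ≡.refl | yes ≡.refl | _          | _          = reflexive (≡.sym update-same)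
  ... | yes _      | no v≢j     | yes ≡.refl | yes ≡.refl =
    reflexive (≡.sym (≡.trans (update-other (inj₂ v≢j)) update-same))
  ... | yes _      | no v≢j     | yes _      | no v≢i     =
    reflexive (≡.sym (≡.trans (update-other (inj₂ v≢j)) (update-other (inj₂ v≢i))))
  ... | yes _      | no v≢j     | no u≢j     | _          =
    reflexive (≡.sym (≡.trans (update-other (inj₂ v≢j)) (update-other (inj₁ u≢j))))
  ... | no u≢i     | _          | yes ≡.refl | yes ≡.refl =
    reflexive (≡.sym (≡.trans (update-other (inj₁ u≢i)) update-same))
  ... | no u≢i     | _          | yes _      | no v≢i     =
    reflexive (≡.sym (≡.trans (update-other (inj₁ u≢i)) (update-other (inj₂ v≢i))))
  ... | no u≢i     | _          | no u≢j     | _          =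
    reflexive (≡.sym (≡.trans (update-other (inj₁ u≢i)) (update-other (inj₁ u≢j))))

  -- Discrete partial derivatives

  Congruent : (Matrix k → Carrier) → Set (c ⊔ ℓ)
  Congruent F = ∀ {X Y} → X ≋ Y → F X ≈ F Y

  Independent : Fin k → Fin k → (Matrix k → Carrier) → Set (c ⊔ ℓ)
  Independent s t F = ∀ X a → F (X [ s , t ]≔ a) ≈ F X

  entry-independent : u ≢ s ⊎ v ≢ t → Independent s t (λ Y → Y u v)
  entry-independent elsewhere X a = reflexive (update-other elsewhere)

  diagonal-independent : ∀ {k} {i j : Fin k} (q : Fin k) → i ≢ j → Independent i j (λ Y → Y q q)
  diagonal-independent {i = i} q i≢j with q ≟ i
  ... | yes ≡.refl = entry-independent (inj₂ i≢j)
  ... | no q≢i     = entry-independent (inj₁ q≢i)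

  minor-row-independent : ∀ {k} (i j : Fin (suc k)) {F : Matrix k → Carrier} {t} →
                          Congruent F → Independent i t (F ∘ minor i j)
  minor-row-independent i j F-cong X a = F-cong (minor-update-row i j)

  minor-col-independent : ∀ {k} (i j : Fin (suc k)) {F : Matrix k → Carrier} {s} →
                          Congruent F → Independent s j (F ∘ minor i j)
  minor-col-independent i j F-cong X a = F-cong (minor-update-col i j)

  opaque
    ∂[_,_] : Fin k → Fin k → (Matrix k → Carrier) → Matrix k → Carrier
    ∂[ s , t ] F X = F (X [ s , t ]≔ 1#) - F (X [ s , t ]≔ 0#)

    ∂-expand : ∂[ s , t ] F X ≡ F (X [ s , t ]≔ 1#) - F (X [ s , t ]≔ 0#)
    ∂-expand = ≡.refl

    ∂∂-expand : ∂[ s , t ] (∂[ s′ , t′ ] F) X ≡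
                (F ((X [ s , t ]≔ 1#) [ s′ , t′ ]≔ 1#) - F ((X [ s , t ]≔ 1#) [ s′ , t′ ]≔ 0#))
                - (F ((X [ s , t ]≔ 0#) [ s′ , t′ ]≔ 1#) - F ((X [ s , t ]≔ 0#) [ s′ , t′ ]≔ 0#))
    ∂∂-expand = ≡.refl

    ∂-cong : (∀ Y → F Y ≈ G Y) → ∂[ s , t ] F X ≈ ∂[ s , t ] G X
    ∂-cong F≈G = +-cong (F≈G _) (-‿cong (F≈G _))

    ∂-congruent : Congruent F → Congruent (∂[ s , t ] F)
    ∂-congruent F-cong X≋Y = +-cong (F-cong (update-cong refl X≋Y)) (-‿cong (F-cong (update-cong refl X≋Y)))

    ∂-independent : Independent s t F → ∂[ s , t ] F X ≈ 0#
    ∂-independent {F = F} {X = X} F-indep =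
      trans (+-cong (F-indep X 1#) (-‿cong (F-indep X 0#))) (-‿inverseʳ (F X))

    ∂-entry : ∂[ s , t ] (λ Y → Y s t) X ≈ 1#
    ∂-entry = trans (+-cong (reflexive update-same) (-‿cong (reflexive update-same)))
                    (trans (+-congˡ -0#≈0#) (+-identityʳ 1#))

    ∂-+ : ∂[ s , t ] (λ Y → F Y + G Y) X ≈ ∂[ s , t ] F X + ∂[ s , t ] G X
    ∂-+ = solve 4 (λ a b c d → (a :+ b) :- (c :+ d) := (a :- c) :+ (b :- d)) refl _ _ _ _

    ∂-- : ∂[ s , t ] (λ Y → F Y - G Y) X ≈ ∂[ s , t ] F X - ∂[ s , t ] G X
    ∂-- = solve 4 (λ a b c d → (a :- b) :- (c :- d) := (a :- c) :- (b :- d)) refl _ _ _ _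

    ∂-neg : ∂[ s , t ] (λ Y → - F Y) X ≈ - ∂[ s , t ] F X
    ∂-neg = solve 2 (λ a b → :- a :- :- b := :- (a :- b)) refl _ _

    ∂-Σ : ∀ {m} (F : Fin m → Matrix k → Carrier) →
          ∂[ s , t ] (λ Y → Σ (λ q → F q Y)) X ≈ Σ (λ q → ∂[ s , t ] (F q) X)
    ∂-Σ {s = s} {t = t} {X = X} F =
      sym (Σ-distrib-- (λ q → F q (X [ s , t ]≔ 1#)) (λ q → F q (X [ s , t ]≔ 0#)))

    ∂-*ˡ : Independent s t F → ∂[ s , t ] (λ Y → F Y * G Y) X ≈ F X * ∂[ s , t ] G X
    ∂-*ˡ {X = X} F-indep =
      trans (+-cong (*-congʳ (F-indep X 1#)) (-‿cong (*-congʳ (F-indep X 0#)))) (sym (x[y-z]≈xy-xz _ _ _))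

    ∂-*ʳ : Independent s t G → ∂[ s , t ] (λ Y → F Y * G Y) X ≈ ∂[ s , t ] F X * G X
    ∂-*ʳ {X = X} G-indep =
      trans (+-cong (*-congˡ (G-indep X 1#)) (-‿cong (*-congˡ (G-indep X 0#)))) (sym ([y-z]x≈yx-zx _ _ _))

    ∂-∘minor : ∀ {k} (i j : Fin (suc k)) {F : Matrix k → Carrier} {X : Matrix (suc k)} {s t} → Congruent F →
               ∂[ punchIn i s , punchIn j t ] (F ∘ minor i j) X ≈ ∂[ s , t ] F (minor i j X)
    ∂-∘minor i j F-cong = +-cong (F-cong (minor-update i j)) (-‿cong (F-cong (minor-update i j)))

  ∂-zero : (∀ Y → F Y ≈ 0#) → ∂[ s , t ] F X ≈ 0#
  ∂-zero F≈0 = trans (∂-cong F≈0) (∂-independent (λ _ _ → refl))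

  ∂-* : Independent s t F ⊎ Independent s t G →
        ∂[ s , t ] (λ Y → F Y * G Y) X ≈ ∂[ s , t ] F X * G X + F X * ∂[ s , t ] G X
  ∂-* {s = s} {t = t} {F = F} {G = G} {X = X} (inj₁ F-indep) = begin
    ∂[ s , t ] (λ Y → F Y * G Y) X                ≈⟨ ∂-*ˡ F-indep ⟩
    F X * ∂[ s , t ] G X                          ≈⟨ +-identityˡ _ ⟨
    0# + F X * ∂[ s , t ] G X                     ≈⟨ +-congʳ (trans (*-congʳ (∂-independent F-indep)) (zeroˡ (G X))) ⟨
    ∂[ s , t ] F X * G X + F X * ∂[ s , t ] G X   ∎
  ∂-* {s = s} {t = t} {F = F} {G = G} {X = X} (inj₂ G-indep) = begin
    ∂[ s , t ] (λ Y → F Y * G Y) X                ≈⟨ ∂-*ʳ G-indep ⟩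
    ∂[ s , t ] F X * G X                          ≈⟨ +-identityʳ _ ⟨
    ∂[ s , t ] F X * G X + 0#                     ≈⟨ +-congˡ (trans (*-congˡ (∂-independent G-indep)) (zeroʳ (F X))) ⟨
    ∂[ s , t ] F X * G X + F X * ∂[ s , t ] G X   ∎

  ∂-comm : Congruent F → s ≢ s′ → ∂[ s , t ] (∂[ s′ , t′ ] F) X ≈ ∂[ s′ , t′ ] (∂[ s , t ] F) X
  ∂-comm {F = F} {s = s} {s′ = s′} {t = t} {t′ = t′} {X = X} F-cong s≢s′ = begin
    ∂[ s , t ] (∂[ s′ , t′ ] F) X  ≡⟨ ∂∂-expand ⟩
    (F₁₁ - F₁₀) - (F₀₁ - F₀₀)      ≈⟨ solve 4 (λ a b c d → (a :- b) :- (c :- d) := (a :- c) :- (b :- d)) refl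
                                             F₁₁ F₁₀ F₀₁ F₀₀ ⟩
    (F₁₁ - F₀₁) - (F₁₀ - F₀₀)      ≈⟨ +-cong (+-cong (swap 1# 1#) (-‿cong (swap 0# 1#)))
                                             (-‿cong (+-cong (swap 1# 0#) (-‿cong (swap 0# 0#)))) ⟩
    _                              ≡⟨ ∂∂-expand ⟨
    ∂[ s′ , t′ ] (∂[ s , t ] F) X  ∎
    where
    F₁₁ = F ((X [ s , t ]≔ 1#) [ s′ , t′ ]≔ 1#)
    F₁₀ = F ((X [ s , t ]≔ 1#) [ s′ , t′ ]≔ 0#)
    F₀₁ = F ((X [ s , t ]≔ 0#) [ s′ , t′ ]≔ 1#)
    F₀₀ = F ((X [ s , t ]≔ 0#) [ s′ , t′ ]≔ 0#)
    swap : ∀ a b → F ((X [ s , t ]≔ a) [ s′ , t′ ]≔ b) ≈ F ((X [ s′ , t′ ]≔ b) [ s , t ]≔ a)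
    swap a b = F-cong (λ u v → sym (update-comm s≢s′ u v))

  -- Affine dependence on one entry

  Affine : Fin k → Fin k → (Matrix k → Carrier) → Set (c ⊔ ℓ)
  Affine s t F = ∀ X a → F (X [ s , t ]≔ a) ≈ F (X [ s , t ]≔ 0#) + a * ∂[ s , t ] F X

  independent⇒affine : Independent s t F → Affine s t F
  independent⇒affine {s = s} {t = t} {F = F} F-indep X a = begin
    F (X [ s , t ]≔ a)                          ≈⟨ F-indep X a ⟩
    F X                                         ≈⟨ +-identityʳ (F X) ⟨
    F X + 0#                                    ≈⟨ +-cong (F-indep X 0#) (trans (*-congˡ (∂-independent F-indep)) (zeroʳ a)) ⟨
    F (X [ s , t ]≔ 0#) + a * ∂[ s , t ] F X    ∎

  entry-affine : Affine s t (λ Y → Y u v)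
  entry-affine {s = s} {t = t} {u = u} {v = v} X a with position? u v s t
  ... | inj₁ (≡.refl , ≡.refl) = begin
    (X [ u , v ]≔ a) u v                                    ≡⟨ update-same ⟩
    a                                                       ≈⟨ trans (+-identityˡ _) (*-identityʳ a) ⟨
    0# + a * 1#                                             ≈⟨ +-cong (reflexive update-same) (*-congˡ ∂-entry) ⟨
    (X [ u , v ]≔ 0#) u v + a * ∂[ u , v ] (λ Y → Y u v) X  ∎
  ... | inj₂ elsewhere = independent⇒affine (entry-independent elsewhere) X a

  Affine-+ : Affine s t F → Affine s t G → Affine s t (λ Y → F Y + G Y)
  Affine-+ {s = s} {t = t} {F = F} {G = G} F-aff G-aff X a = begin
    F (X [ s , t ]≔ a) + G (X [ s , t ]≔ a)                ≈⟨ +-cong (F-aff X a) (G-aff X a) ⟩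
    (F₀ + a * ∂[ s , t ] F X) + (G₀ + a * ∂[ s , t ] G X)
      ≈⟨ solve 5 (λ a f g d e → (f :+ a :* d) :+ (g :+ a :* e) := (f :+ g) :+ a :* (d :+ e)) refl a F₀ G₀ _ _ ⟩
    (F₀ + G₀) + a * (∂[ s , t ] F X + ∂[ s , t ] G X)      ≈⟨ +-congˡ (*-congˡ ∂-+) ⟨
    (F₀ + G₀) + a * ∂[ s , t ] (λ Y → F Y + G Y) X         ∎
    where
    F₀ = F (X [ s , t ]≔ 0#)
    G₀ = G (X [ s , t ]≔ 0#)

  Affine-- : Affine s t F → Affine s t G → Affine s t (λ Y → F Y - G Y)
  Affine-- {s = s} {t = t} {F = F} {G = G} F-aff G-aff X a = begin
    F (X [ s , t ]≔ a) - G (X [ s , t ]≔ a)                ≈⟨ +-cong (F-aff X a) (-‿cong (G-aff X a)) ⟩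
    (F₀ + a * ∂[ s , t ] F X) - (G₀ + a * ∂[ s , t ] G X)
      ≈⟨ solve 5 (λ a f g d e → (f :+ a :* d) :- (g :+ a :* e) := (f :- g) :+ a :* (d :- e)) refl a F₀ G₀ _ _ ⟩
    (F₀ - G₀) + a * (∂[ s , t ] F X - ∂[ s , t ] G X)      ≈⟨ +-congˡ (*-congˡ ∂--) ⟨
    (F₀ - G₀) + a * ∂[ s , t ] (λ Y → F Y - G Y) X         ∎
    where
    F₀ = F (X [ s , t ]≔ 0#)
    G₀ = G (X [ s , t ]≔ 0#)

  Affine-Σ : ∀ {m} {F : Fin m → Matrix k → Carrier} → (∀ q → Affine s t (F q)) →
             Affine s t (λ Y → Σ (λ q → F q Y))
  Affine-Σ {m = zero}          F-aff = independent⇒affine (λ _ _ → refl)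
  Affine-Σ {m = suc m} {F = F} F-aff = Affine-+ {F = F zero} (F-aff zero) (Affine-Σ {F = F ∘ suc} (F-aff ∘ suc))

  Affine-* : Independent s t F ⊎ Independent s t G → Affine s t F → Affine s t G →
             Affine s t (λ Y → F Y * G Y)
  Affine-* {s = s} {t = t} {F = F} {G = G} (inj₁ F-indep) F-aff G-aff X a = begin
    F (X [ s , t ]≔ a) * G (X [ s , t ]≔ a)     ≈⟨ *-cong (F-indep X a) (G-aff X a) ⟩
    F X * (G₀ + a * ∂[ s , t ] G X)
      ≈⟨ solve 4 (λ a f g d → f :* (g :+ a :* d) := f :* g :+ a :* (f :* d)) refl a (F X) G₀ _ ⟩
    F X * G₀ + a * (F X * ∂[ s , t ] G X)       ≈⟨ +-cong (*-congʳ (F-indep X 0#)) (*-congˡ (∂-*ˡ F-indep)) ⟨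
    F (X [ s , t ]≔ 0#) * G₀ + a * ∂[ s , t ] (λ Y → F Y * G Y) X ∎
    where G₀ = G (X [ s , t ]≔ 0#)
  Affine-* {s = s} {t = t} {F = F} {G = G} (inj₂ G-indep) F-aff G-aff X a = begin
    F (X [ s , t ]≔ a) * G (X [ s , t ]≔ a)     ≈⟨ *-cong (F-aff X a) (G-indep X a) ⟩
    (F₀ + a * ∂[ s , t ] F X) * G X
      ≈⟨ solve 4 (λ a f g d → (f :+ a :* d) :* g := f :* g :+ a :* (d :* g)) refl a F₀ (G X) _ ⟩
    F₀ * G X + a * (∂[ s , t ] F X * G X)       ≈⟨ +-cong (*-congˡ (G-indep X 0#)) (*-congˡ (∂-*ʳ G-indep)) ⟨
    F₀ * G (X [ s , t ]≔ 0#) + a * ∂[ s , t ] (λ Y → F Y * G Y) X ∎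
    where F₀ = F (X [ s , t ]≔ 0#)

  Affine-scale : ∀ x → Affine s t F → Affine s t (λ Y → x * F Y)
  Affine-scale x F-aff = Affine-* (inj₁ (λ _ _ → refl)) (independent⇒affine (λ _ _ → refl)) F-aff

  Affine-∘minor : ∀ {k} (i j : Fin (suc k)) {F : Matrix k → Carrier} → Congruent F → (∀ s t → Affine s t F) →
                  ∀ s t → Affine s t (F ∘ minor i j)
  Affine-∘minor i j {F} F-cong F-aff s t with punchView i s | punchView j t
  ... | here     | _        = independent⇒affine (minor-row-independent i j F-cong)
  ... | there s′ | here     = independent⇒affine (minor-col-independent i j F-cong)
  ... | there s′ | there t′ = λ X a → begin
    F (minor i j (X [ punchIn i s′ , punchIn j t′ ]≔ a))               ≈⟨ F-cong (minor-update i j) ⟩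
    F (minor i j X [ s′ , t′ ]≔ a)                                      ≈⟨ F-aff s′ t′ (minor i j X) a ⟩
    F (minor i j X [ s′ , t′ ]≔ 0#) + a * ∂[ s′ , t′ ] F (minor i j X)
      ≈⟨ +-cong (F-cong (minor-update i j)) (*-congˡ (∂-∘minor i j F-cong)) ⟨
    F (minor i j (X [ punchIn i s′ , punchIn j t′ ]≔ 0#))
      + a * ∂[ punchIn i s′ , punchIn j t′ ] (F ∘ minor i j) X ∎

  Affine-∂ : Congruent F → s ≢ s′ → Affine s′ t′ F → Affine s′ t′ (∂[ s , t ] F)
  Affine-∂ {F = F} {s = s} {s′ = s′} {t′ = t′} {t = t} F-cong s≢s′ F-aff X a = begin
    ∂[ s , t ] F (X [ s′ , t′ ]≔ a)                                               ≡⟨ ∂-expand ⟩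
    F ((X [ s′ , t′ ]≔ a) [ s , t ]≔ 1#) - F ((X [ s′ , t′ ]≔ a) [ s , t ]≔ 0#)
      ≈⟨ +-cong (swap 1# a) (-‿cong (swap 0# a)) ⟩
    F ((X [ s , t ]≔ 1#) [ s′ , t′ ]≔ a) - F ((X [ s , t ]≔ 0#) [ s′ , t′ ]≔ a)
      ≈⟨ +-cong (F-aff (X [ s , t ]≔ 1#) a) (-‿cong (F-aff (X [ s , t ]≔ 0#) a)) ⟩
    (F₁₀ + a * ∂[ s′ , t′ ] F (X [ s , t ]≔ 1#)) - (F₀₀ + a * ∂[ s′ , t′ ] F (X [ s , t ]≔ 0#))
      ≈⟨ solve 5 (λ a f g d e → (f :+ a :* d) :- (g :+ a :* e) := (f :- g) :+ a :* (d :- e)) refl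
                 a F₁₀ F₀₀ _ _ ⟩
    (F₁₀ - F₀₀) + a * (∂[ s′ , t′ ] F (X [ s , t ]≔ 1#) - ∂[ s′ , t′ ] F (X [ s , t ]≔ 0#))
      ≈⟨ +-cong (+-cong (swap 1# 0#) (-‿cong (swap 0# 0#))) (*-congˡ (reflexive ∂-expand)) ⟨
    (F ((X [ s′ , t′ ]≔ 0#) [ s , t ]≔ 1#) - F ((X [ s′ , t′ ]≔ 0#) [ s , t ]≔ 0#))
      + a * ∂[ s , t ] (∂[ s′ , t′ ] F) X
      ≈⟨ +-cong (reflexive (≡.sym ∂-expand)) (*-congˡ (∂-comm F-cong s≢s′)) ⟩
    ∂[ s , t ] F (X [ s′ , t′ ]≔ 0#) + a * ∂[ s′ , t′ ] (∂[ s , t ] F) X ∎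
    where
    F₁₀ = F ((X [ s , t ]≔ 1#) [ s′ , t′ ]≔ 0#)
    F₀₀ = F ((X [ s , t ]≔ 0#) [ s′ , t′ ]≔ 0#)
    swap : ∀ b a → F ((X [ s′ , t′ ]≔ a) [ s , t ]≔ b) ≈ F ((X [ s , t ]≔ b) [ s′ , t′ ]≔ a)
    swap b a = F-cong (update-comm s≢s′)

  affine-expansion : Congruent F → Affine s t F → F (X [ s , t ]≔ 0#) ≈ F X - X s t * ∂[ s , t ] F X
  affine-expansion {F = F} {s = s} {t = t} {X = X} F-cong F-aff = begin
    F₀                          ≈⟨ solve 2 (λ f d → f := (f :+ d) :- d) refl F₀ d ⟩
    (F₀ + d) - d                ≈⟨ +-congʳ (F-aff X (X s t)) ⟨
    F (X [ s , t ]≔ X s t) - d  ≈⟨ +-congʳ (F-cong update-self) ⟩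
    F X - d                     ∎
    where
    F₀ = F (X [ s , t ]≔ 0#)
    d  = X s t * ∂[ s , t ] F X

  affine-expansion₂ : Congruent F → s ≢ s′ → Affine s t F → Affine s′ t′ F →
                      F ((X [ s′ , t′ ]≔ 0#) [ s , t ]≔ 0#) ≈
                      F X - X s t * ∂[ s , t ] F X - X s′ t′ * ∂[ s′ , t′ ] F X
                          + (X s t * X s′ t′) * ∂[ s′ , t′ ] (∂[ s , t ] F) X
  affine-expansion₂ {F = F} {s = s} {s′ = s′} {t = t} {t′ = t′} {X = X} F-cong s≢s′ F-aff F-aff′ = begin
    F (X′ [ s , t ]≔ 0#)                 ≈⟨ affine-expansion F-cong F-aff ⟩
    F X′ - X′ s t * ∂[ s , t ] F X′
      ≈⟨ +-cong (affine-expansion F-cong F-aff′)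
                (-‿cong (*-cong (reflexive (update-other (inj₁ s≢s′)))
                                (affine-expansion (∂-congruent F-cong) (Affine-∂ F-cong s≢s′ F-aff′)))) ⟩
    (F X - y * ∂[ s′ , t′ ] F X) - x * (∂[ s , t ] F X - y * ∂[ s′ , t′ ] (∂[ s , t ] F) X)
      ≈⟨ solve 6 (λ f x y d e g → (f :- y :* e) :- x :* (d :- y :* g) := f :- x :* d :- y :* e :+ (x :* y) :* g)
                 refl (F X) x y (∂[ s , t ] F X) (∂[ s′ , t′ ] F X) (∂[ s′ , t′ ] (∂[ s , t ] F) X) ⟩
    F X - x * ∂[ s , t ] F X - y * ∂[ s′ , t′ ] F X + (x * y) * ∂[ s′ , t′ ] (∂[ s , t ] F) X ∎
    where
    X′ = X [ s′ , t′ ]≔ 0#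
    x  = X s t
    y  = X s′ t′

  -- Euler's identity for homogeneous functions

  euler : (Matrix k → Carrier) → Matrix k → Carrier
  euler F X = Σ (λ s → Σ (λ t → X s t * ∂[ s , t ] F X))

  Homogeneous : ℕ → (Matrix k → Carrier) → Set (c ⊔ ℓ)
  Homogeneous d F = ∀ X → euler F X ≈ d · F X

  Separated : (F G : Matrix k → Carrier) → Set (c ⊔ ℓ)
  Separated F G = ∀ s t → Independent s t F ⊎ Independent s t G

  *-∂-independent : Independent s t F → X s t * ∂[ s , t ] F X ≈ 0#
  *-∂-independent F-indep = trans (*-congˡ (∂-independent F-indep)) (zeroʳ _)

  Homogeneous-const : ∀ {k} x → Homogeneous 0 (λ (_ : Matrix k) → x)
  Homogeneous-const {k} x X = Σ-zero (λ s → Σ-zero {f = term s} (λ t → *-∂-independent (λ _ _ → refl)))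
    where
    term : Fin k → Fin k → Carrier
    term s t = X s t * ∂[ s , t ] (λ _ → x) X

  Homogeneous-entry : ∀ {k} (a b : Fin (suc k)) → Homogeneous 1 (λ Y → Y a b)
  Homogeneous-entry {k} a b X = begin
    euler (λ Y → Y a b) X
      ≈⟨ Σ-single a (λ s → Σ (term s)) (λ s → Σ-zero {f = term (punchIn a s)} (λ t → *-∂-independent
                                               (entry-independent (inj₁ (punchInᵢ≢i a s ∘ ≡.sym))))) ⟩
    Σ (term a)
      ≈⟨ Σ-single b (term a) (λ t → *-∂-independent (entry-independent (inj₂ (punchInᵢ≢i b t ∘ ≡.sym)))) ⟩
    X a b * ∂[ a , b ] (λ Y → Y a b) X  ≈⟨ trans (*-congˡ ∂-entry) (*-identityʳ _) ⟩
    X a b                               ≈⟨ +-identityʳ _ ⟨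
    1 · X a b                           ∎
    where
    term : Fin (suc k) → Fin (suc k) → Carrier
    term s t = X s t * ∂[ s , t ] (λ Y → Y a b) X

  Homogeneous-- : ∀ {k d} {F G : Matrix k → Carrier} → Homogeneous d F → Homogeneous d G →
                  Homogeneous d (λ Y → F Y - G Y)
  Homogeneous-- {k} {d} {F} {G} F-hom G-hom X = begin
    euler (λ Y → F Y - G Y) X
      ≈⟨ ΣΣ-cong {k} (λ s t → trans (*-congˡ ∂--) (x[y-z]≈xy-xz _ _ _)) ⟩
    Σ (λ s → Σ (λ t → X s t * ∂[ s , t ] F X - X s t * ∂[ s , t ] G X))
      ≈⟨ ΣΣ-distrib-- (λ s t → X s t * ∂[ s , t ] F X) (λ s t → X s t * ∂[ s , t ] G X) ⟩
    euler F X - euler G X  ≈⟨ +-cong (F-hom X) (-‿cong (G-hom X)) ⟩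
    d · F X - d · G X      ≈⟨ ·-distrib-- d _ _ ⟨
    d · (F X - G X)        ∎

  Homogeneous-Σ : ∀ {k d m} {F : Fin m → Matrix k → Carrier} → (∀ q → Homogeneous d (F q)) →
                  Homogeneous d (λ Y → Σ (λ q → F q Y))
  Homogeneous-Σ {k} {d} {F = F} F-hom X = begin
    euler (λ Y → Σ (λ q → F q Y)) X
      ≈⟨ ΣΣ-cong {k} (λ s t → trans (*-congˡ (∂-Σ F)) (*-distribˡ-Σ (X s t) (λ q → ∂[ s , t ] (F q) X))) ⟩
    Σ (λ s → Σ (λ t → Σ (λ q → X s t * ∂[ s , t ] (F q) X)))
      ≈⟨ Σ-cong (λ s → Σ-comm (λ t q → X s t * ∂[ s , t ] (F q) X)) ⟩
    Σ (λ s → Σ (λ q → Σ (λ t → X s t * ∂[ s , t ] (F q) X)))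
      ≈⟨ Σ-comm (λ s q → Σ (λ t → X s t * ∂[ s , t ] (F q) X)) ⟩
    Σ (λ q → euler (F q) X)  ≈⟨ Σ-cong (λ q → F-hom q X) ⟩
    Σ (λ q → d · F q X)      ≈⟨ ·-distrib-Σ d (λ q → F q X) ⟨
    d · Σ (λ q → F q X)      ∎

  Homogeneous-* : ∀ {k} {F G : Matrix k → Carrier} {p q} → Separated F G → Homogeneous p F → Homogeneous q G →
                  Homogeneous (p ℕ.+ q) (λ Y → F Y * G Y)
  Homogeneous-* {k} {F} {G} {p} {q} separated F-hom G-hom X = begin
    euler (λ Y → F Y * G Y) X
      ≈⟨ ΣΣ-cong {k} (λ s t → trans (*-congˡ (∂-* (separated s t)))
           (solve 5 (λ x d f e g → x :* (d :* g :+ f :* e) := x :* d :* g :+ f :* (x :* e)) refl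
                    (X s t) (∂[ s , t ] F X) (F X) (∂[ s , t ] G X) (G X))) ⟩
    Σ (λ s → Σ (λ t → F′ s t * G X + F X * G′ s t))
      ≈⟨ ΣΣ-distrib-+ (λ s t → F′ s t * G X) (λ s t → F X * G′ s t) ⟩
    Σ (λ s → Σ (λ t → F′ s t * G X)) + Σ (λ s → Σ (λ t → F X * G′ s t))
      ≈⟨ +-cong (ΣΣ-distribʳ-* (G X) F′) (ΣΣ-distribˡ-* (F X) G′) ⟨
    euler F X * G X + F X * euler G X  ≈⟨ +-cong (*-congʳ (F-hom X)) (*-congˡ (G-hom X)) ⟩
    p · F X * G X + F X * q · G X      ≈⟨ +-cong (×-assoc-* p (F X) (G X)) (×-comm-* q (F X) (G X)) ⟩
    p · (F X * G X) + q · (F X * G X)  ≈⟨ ×-homo-+ _ p q ⟨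
    (p ℕ.+ q) · (F X * G X)            ∎
    where
    F′ G′ : Fin k → Fin k → Carrier
    F′ s t = X s t * ∂[ s , t ] F X
    G′ s t = X s t * ∂[ s , t ] G X

  Homogeneous-scale : ∀ {k d} x {F : Matrix k → Carrier} → Homogeneous d F → Homogeneous d (λ Y → x * F Y)
  Homogeneous-scale {d = d} x F-hom =
    Homogeneous-* {p = 0} {q = d} (λ _ _ → inj₁ (λ _ _ → refl)) (Homogeneous-const x) F-hom

  euler-∘minor : ∀ {k} (a b : Fin (suc k)) {F : Matrix k → Carrier} → Congruent F →
                 ∀ X → euler (F ∘ minor a b) X ≈ euler F (minor a b X)
  euler-∘minor {k} a b {F} F-cong X = begin
    euler (F ∘ minor a b) X
      ≈⟨ Σ-punchIn a (λ s → Σ (term s))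
                   (Σ-zero {f = term a} (λ t → *-∂-independent (minor-row-independent a b F-cong))) ⟩
    Σ (λ s → Σ (term (punchIn a s)))
      ≈⟨ Σ-cong (λ s → Σ-punchIn b (term (punchIn a s)) (*-∂-independent (minor-col-independent a b F-cong))) ⟩
    Σ (λ s → Σ (λ t → term (punchIn a s) (punchIn b t)))
      ≈⟨ ΣΣ-cong {k} (λ s t → *-congˡ (∂-∘minor a b F-cong)) ⟩
    euler F (minor a b X) ∎
    where
    term : Fin (suc k) → Fin (suc k) → Carrier
    term s t = X s t * ∂[ s , t ] (F ∘ minor a b) X

  Homogeneous-∘minor : ∀ {k d} (a b : Fin (suc k)) {F : Matrix k → Carrier} → Congruent F → Homogeneous d F →
                       Homogeneous d (F ∘ minor a b)
  Homogeneous-∘minor a b F-cong F-hom X = trans (euler-∘minor a b F-cong X) (F-hom (minor a b X))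

  -- det (suc k) and d₂ (suc k) are, definitionally, sums of such terms: along row 0 and along the diagonal.
  entry*minor : Fin (suc k) → Fin (suc k) → (Matrix k → Carrier) → Matrix (suc k) → Carrier
  entry*minor a b F Y = Y a b * F (minor a b Y)

  entry*minor-separated : ∀ {k} (a b : Fin (suc k)) {F : Matrix k → Carrier} → Congruent F →
                          Separated (λ Y → Y a b) (F ∘ minor a b)
  entry*minor-separated a b F-cong s t with a ≟ s
  ... | yes ≡.refl = inj₂ (minor-row-independent a b F-cong)
  ... | no a≢s     = inj₁ (entry-independent (inj₁ a≢s))

  entry*minor-congruent : ∀ {k} (a b : Fin (suc k)) {F : Matrix k → Carrier} → Congruent F →
                          Congruent (entry*minor a b F)
  entry*minor-congruent a b F-cong X≋Y = *-cong (X≋Y a b) (F-cong (minor-cong a b X≋Y))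

  entry*minor-affine : ∀ {k} (a b : Fin (suc k)) {F : Matrix k → Carrier} → Congruent F →
                       (∀ s t → Affine s t F) → ∀ s t → Affine s t (entry*minor a b F)
  entry*minor-affine a b F-cong F-aff s t =
    Affine-* (entry*minor-separated a b F-cong s t) entry-affine (Affine-∘minor a b F-cong F-aff s t)

  entry*minor-homogeneous : ∀ {k d} (a b : Fin (suc k)) {F : Matrix k → Carrier} → Congruent F →
                            Homogeneous d F → Homogeneous (suc d) (entry*minor a b F)
  entry*minor-homogeneous {d = d} a b F-cong F-hom =
    Homogeneous-* {p = 1} {q = d} (entry*minor-separated a b F-cong) (Homogeneous-entry a b)
                  (Homogeneous-∘minor {d = d} a b F-cong F-hom)

  -- The determinant

  det-congruent : ∀ k → Congruent (det k)
  det-congruent zero    X≋Y = refl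
  det-congruent (suc k) {X} {Y} X≋Y = Σ-cong row-0
    where
    row-0 : ∀ j → alt (toℕ j) * entry*minor zero j (det k) X ≈ alt (toℕ j) * entry*minor zero j (det k) Y
    row-0 j = *-congˡ (entry*minor-congruent zero j (det-congruent k) X≋Y)

  det-affine : ∀ k (s t : Fin k) → Affine s t (det k)
  det-affine (suc k) s t =
    Affine-Σ (λ j → Affine-scale (alt (toℕ j)) (entry*minor-affine zero j (det-congruent k) (det-affine k) s t))

  det-homogeneous : ∀ k → Homogeneous k (det k)
  det-homogeneous zero    = Homogeneous-const 1#
  det-homogeneous (suc k) =
    Homogeneous-Σ {d = suc k} (λ j → Homogeneous-scale {d = suc k} (alt (toℕ j))
                                       (entry*minor-homogeneous {d = k} zero j (det-congruent k) (det-homogeneous k)))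

  ∂-det-row-0 : ∀ k (s t : Fin (suc k)) X →
                ∂[ s , t ] (det (suc k)) X ≈ Σ (λ j → alt (toℕ j) * ∂[ s , t ] (entry*minor zero j (det k)) X)
  ∂-det-row-0 k s t X = trans (∂-Σ (λ j Y → alt (toℕ j) * entry*minor zero j (det k) Y)) (Σ-cong scale)
    where
    scale : ∀ j → ∂[ s , t ] (λ Y → alt (toℕ j) * entry*minor zero j (det k) Y) X ≈
                  alt (toℕ j) * ∂[ s , t ] (entry*minor zero j (det k)) X
    scale j = ∂-*ˡ (λ _ _ → refl)

  ∂-det : ∀ k (s t : Fin (suc k)) X → ∂[ s , t ] (det (suc k)) X ≈ alt (toℕ s ℕ.+ toℕ t) * det k (minor s t X)
  ∂-det k zero t X = begin
    ∂[ zero , t ] (det (suc k)) X                                          ≈⟨ ∂-det-row-0 k zero t X ⟩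
    Σ (λ j → alt (toℕ j) * ∂[ zero , t ] (entry*minor zero j (det k)) X)  ≈⟨ Σ-cong minor-constant ⟩
    Σ term                                                                  ≈⟨ Σ-single t term off-column ⟩
    term t                                ≈⟨ *-congˡ (trans (*-congʳ ∂-entry) (*-identityˡ _)) ⟩
    alt (toℕ t) * det k (minor zero t X)  ∎
    where
    term : Fin (suc k) → Carrier
    term j = alt (toℕ j) * (∂[ zero , t ] (λ Y → Y zero j) X * det k (minor zero j X))
    minor-constant : ∀ j → alt (toℕ j) * ∂[ zero , t ] (entry*minor zero j (det k)) X ≈ term j
    minor-constant j = *-congˡ (∂-*ʳ (minor-row-independent zero j (det-congruent k)))
    off-column : ∀ j → term (punchIn t j) ≈ 0#
    off-column j = trans (*-congˡ (trans (*-congʳ (∂-independent (entry-independent (inj₂ (punchInᵢ≢i t j)))))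
                                         (zeroˡ _)))
                         (zeroʳ _)
  ∂-det (suc k) (suc s) t X = begin
    ∂[ suc s , t ] (det (suc (suc k))) X
      ≈⟨ ∂-det-row-0 (suc k) (suc s) t X ⟩
    Σ (λ j → alt (toℕ j) * ∂[ suc s , t ] (entry*minor zero j (det (suc k))) X)
      ≈⟨ Σ-cong entry-constant ⟩
    Σ term
      ≈⟨ Σ-punchIn t term column-t ⟩
    Σ (term ∘ punchIn t)
      ≈⟨ Σ-cong moved ⟩
    Σ (λ j → alt (toℕ (suc s) ℕ.+ toℕ t) * (alt (toℕ j) * entry*minor zero j (det k) (minor (suc s) t X)))
      ≈⟨ *-distribˡ-Σ _ (λ j → alt (toℕ j) * entry*minor zero j (det k) (minor (suc s) t X)) ⟨
    alt (toℕ (suc s) ℕ.+ toℕ t) * det (suc k) (minor (suc s) t X) ∎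
    where
    term : Fin (suc (suc k)) → Carrier
    term j = alt (toℕ j) * (X zero j * ∂[ suc s , t ] (det (suc k) ∘ minor zero j) X)
    entry-constant : ∀ j → alt (toℕ j) * ∂[ suc s , t ] (entry*minor zero j (det (suc k))) X ≈ term j
    entry-constant j = *-congˡ (∂-*ˡ (entry-independent (inj₁ λ ())))
    column-t : term t ≈ 0#
    column-t = trans (*-congˡ (trans (*-congˡ (∂-independent (minor-col-independent zero t (det-congruent (suc k)))))
                                     (zeroʳ _)))
                     (zeroʳ _)
    moved : ∀ j → term (punchIn t j) ≈
                  alt (toℕ (suc s) ℕ.+ toℕ t) * (alt (toℕ j) * entry*minor zero j (det k) (minor (suc s) t X))
    moved j = begin
      alt (toℕ p) * (X zero p * ∂[ suc s , t ] (det (suc k) ∘ minor zero p) X)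
        ≡⟨ ≡.cong (λ u → alt (toℕ p) * (X zero p * ∂[ suc s , u ] (det (suc k) ∘ minor zero p) X))
                  (≡.sym (punchIn-punchOut p≢t)) ⟩
      alt (toℕ p) * (X zero p * ∂[ suc s , punchIn p q ] (det (suc k) ∘ minor zero p) X)
        ≈⟨ *-congˡ (*-congˡ (trans (∂-∘minor zero p (det-congruent (suc k))) (∂-det k s q (minor zero p X)))) ⟩
      alt (toℕ p) * (X zero p * (alt (toℕ s ℕ.+ toℕ q) * det k (minor s q (minor zero p X))))
        ≈⟨ *-congˡ (*-congˡ (*-cong (alt-+ (toℕ s) (toℕ q)) (det-congruent k swapped))) ⟩
      alt (toℕ p) * (X zero p * ((alt (toℕ s) * alt (toℕ q)) * D))
        ≈⟨ solve 5 (λ a x s c d → a :* (x :* ((s :* c) :* d)) := (a :* c) :* (s :* (x :* d))) refl _ _ _ _ _ ⟩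
      (alt (toℕ p) * alt (toℕ q)) * (alt (toℕ s) * (X zero p * D))
        ≈⟨ *-congʳ signs ⟩
      - (alt (toℕ t) * alt (toℕ j)) * (alt (toℕ s) * (X zero p * D))
        ≈⟨ solve 5 (λ t j s x d → (:- (t :* j)) :* (s :* (x :* d)) := (:- (s :* t)) :* (j :* (x :* d))) refl
                   _ _ _ _ _ ⟩
      - (alt (toℕ s) * alt (toℕ t)) * (alt (toℕ j) * (X zero p * D))
        ≈⟨ *-congʳ (-‿cong (alt-+ (toℕ s) (toℕ t))) ⟨
      alt (toℕ (suc s) ℕ.+ toℕ t) * (alt (toℕ j) * entry*minor zero j (det k) (minor (suc s) t X)) ∎
      where
      p = punchIn t j
      p≢t = punchInᵢ≢i t j
      t≢p = punchInᵢ≢i t j ∘ ≡.sym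
      q = punchOut p≢t
      D = det k (minor zero j (minor (suc s) t X))
      swapped : minor s q (minor zero p X) ≋ minor zero j (minor (suc s) t X)
      swapped u v = reflexive (≡.cong (X (suc (punchIn s u)))
                                      (≡.trans (punchIn-swap p≢t t≢p v)
                                               (≡.cong (λ r → punchIn t (punchIn r v)) (punchOut-punchIn t))))
      signs : alt (toℕ p) * alt (toℕ q) ≈ - (alt (toℕ t) * alt (toℕ j))
      signs = begin
        alt (toℕ p) * alt (toℕ q)             ≈⟨ alt-+ (toℕ p) (toℕ q) ⟨
        alt (toℕ p ℕ.+ toℕ q)                 ≈⟨ alt-punchOut p≢t t≢p ⟩
        - alt (toℕ t ℕ.+ toℕ (punchOut t≢p))  ≡⟨ ≡.cong (λ r → - alt (toℕ t ℕ.+ toℕ r)) (punchOut-punchIn t) ⟩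
        - alt (toℕ t ℕ.+ toℕ j)               ≈⟨ -‿cong (alt-+ (toℕ t) (toℕ j)) ⟩
        - (alt (toℕ t) * alt (toℕ j))         ∎

  ∂-det-diagonal : ∀ k (q : Fin (suc k)) X → ∂[ q , q ] (det (suc k)) X ≈ det k (minor q q X)
  ∂-det-diagonal k q X =
    trans (∂-det k q q X) (trans (*-congʳ (trans (alt-+ (toℕ q) (toℕ q)) (alt-square (toℕ q)))) (*-identityˡ _))

  minor-minor≋deleteTwo : ∀ {k} {i j : Fin (suc (suc k))} (i≢j : i ≢ j) (X : Matrix (suc (suc k))) →
                          minor (punchOut i≢j) (punchOut (i≢j ∘ ≡.sym)) (minor i j X) ≋ deleteTwo i j i≢j X
  minor-minor≋deleteTwo i≢j X u v = reflexive (≡.cong (λ r → X r _) (punchIn-swap i≢j (i≢j ∘ ≡.sym) u))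

  ∂∂-det : ∀ k (i j : Fin (suc (suc k))) (i≢j : i ≢ j) X →
           ∂[ j , i ] (∂[ i , j ] (det (suc (suc k)))) X ≈ - det k (deleteTwo i j i≢j X)
  ∂∂-det k i j i≢j X = begin
    ∂[ j , i ] (∂[ i , j ] (det (suc (suc k)))) X
      ≈⟨ ∂-cong (∂-det (suc k) i j) ⟩
    ∂[ j , i ] (λ Y → alt (toℕ i ℕ.+ toℕ j) * det (suc k) (minor i j Y)) X
      ≈⟨ ∂-*ˡ (λ _ _ → refl) ⟩
    alt (toℕ i ℕ.+ toℕ j) * ∂[ j , i ] (det (suc k) ∘ minor i j) X
      ≡⟨ ≡.cong₂ (λ r c → alt (toℕ i ℕ.+ toℕ j) * ∂[ r , c ] (det (suc k) ∘ minor i j) X)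
                 (≡.sym (punchIn-punchOut i≢j)) (≡.sym (punchIn-punchOut j≢i)) ⟩
    alt (toℕ i ℕ.+ toℕ j) * ∂[ punchIn i j′ , punchIn j i′ ] (det (suc k) ∘ minor i j) X
      ≈⟨ *-congˡ (trans (∂-∘minor i j (det-congruent (suc k))) (∂-det k j′ i′ (minor i j X))) ⟩
    alt (toℕ i ℕ.+ toℕ j) * (alt (toℕ j′ ℕ.+ toℕ i′) * det k (minor j′ i′ (minor i j X)))
      ≈⟨ *-cong (alt-+ (toℕ i) (toℕ j))
                (*-cong (alt-+ (toℕ j′) (toℕ i′)) (det-congruent k (minor-minor≋deleteTwo i≢j X))) ⟩
    (alt (toℕ i) * alt (toℕ j)) * ((alt (toℕ j′) * alt (toℕ i′)) * D)
      ≈⟨ solve 5 (λ a b c e d → (a :* b) :* ((c :* e) :* d) := (a :* c) :* (b :* e) :* d) refl _ _ _ _ _ ⟩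
    (alt (toℕ i) * alt (toℕ j′)) * (alt (toℕ j) * alt (toℕ i′)) * D
      ≈⟨ *-congʳ (*-cong (alt-+ (toℕ i) (toℕ j′)) (alt-+ (toℕ j) (toℕ i′))) ⟨
    alt (toℕ i ℕ.+ toℕ j′) * alt (toℕ j ℕ.+ toℕ i′) * D
      ≈⟨ *-congʳ (*-congʳ (alt-punchOut i≢j j≢i)) ⟩
    - alt (toℕ j ℕ.+ toℕ i′) * alt (toℕ j ℕ.+ toℕ i′) * D
      ≈⟨ solve 2 (λ a d → :- a :* a :* d := :- (a :* a :* d)) refl _ _ ⟩
    - (alt (toℕ j ℕ.+ toℕ i′) * alt (toℕ j ℕ.+ toℕ i′) * D)
      ≈⟨ -‿cong (trans (*-congʳ (alt-square (toℕ j ℕ.+ toℕ i′))) (*-identityˡ D)) ⟩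
    - D ∎
    where
    j≢i = i≢j ∘ ≡.sym
    j′ = punchOut i≢j
    i′ = punchOut j≢i
    D = det k (deleteTwo i j i≢j X)

  -- The second immanant

  d₂-congruent : ∀ k → Congruent (d₂ k)
  d₂-congruent zero    X≋Y = refl
  d₂-congruent (suc k) {X} {Y} X≋Y = +-cong (Σ-cong diagonal) (-‿cong (det-congruent (suc k) X≋Y))
    where
    diagonal : ∀ q → entry*minor q q (det k) X ≈ entry*minor q q (det k) Y
    diagonal q = entry*minor-congruent q q (det-congruent k) X≋Y

  d₂-affine : ∀ k (s t : Fin k) → Affine s t (d₂ k)
  d₂-affine (suc k) s t =
    Affine-- (Affine-Σ (λ q → entry*minor-affine q q (det-congruent k) (det-affine k) s t)) (det-affine (suc k) s t)

  d₂-homogeneous : ∀ k → Homogeneous k (d₂ k)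
  d₂-homogeneous zero    = Homogeneous-const (- 1#)
  d₂-homogeneous (suc k) =
    Homogeneous-- {d = suc k}
      (Homogeneous-Σ {d = suc k} (λ q → entry*minor-homogeneous {d = k} q q (det-congruent k) (det-homogeneous k)))
      (det-homogeneous (suc k))

  d₂≈Σ∂det : ∀ k X → d₂ k X ≈ Σ (λ q → X q q * ∂[ q , q ] (det k) X) - det k X
  d₂≈Σ∂det zero    X = sym (+-identityˡ _)
  d₂≈Σ∂det (suc k) X = +-congʳ (Σ-cong diagonal)
    where
    diagonal : ∀ q → entry*minor q q (det k) X ≈ X q q * ∂[ q , q ] (det (suc k)) X
    diagonal q = *-congˡ (sym (∂-det-diagonal k q X))

  ∂∂-d₂ : ∀ k (i j : Fin (suc (suc k))) (i≢j : i ≢ j) X →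
          ∂[ j , i ] (∂[ i , j ] (d₂ (suc (suc k)))) X ≈ - d₂ k (deleteTwo i j i≢j X)
  ∂∂-d₂ k i j i≢j X = begin
    ∂[ j , i ] (∂[ i , j ] (d₂ (suc (suc k)))) X
      ≈⟨ ∂-cong (λ Y → trans ∂-- (+-congʳ (∂-Σ T))) ⟩
    ∂[ j , i ] (λ Y → Σ (λ q → ∂[ i , j ] (T q) Y) - ∂[ i , j ] (det (suc (suc k))) Y) X
      ≈⟨ trans ∂-- (+-congʳ (∂-Σ (λ q → ∂[ i , j ] (T q)))) ⟩
    Σ (λ q → ∂[ j , i ] (∂[ i , j ] (T q)) X) - ∂[ j , i ] (∂[ i , j ] (det (suc (suc k)))) X
      ≈⟨ +-cong (Σ-cong factor-entry) (-‿cong (∂∂-det k i j i≢j X)) ⟩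
    Σ term - - det k Δ
      ≈⟨ +-congʳ (trans (Σ-punchIn j term term-at-j) (Σ-punchIn p (term ∘ punchIn j) term-at-i)) ⟩
    Σ (λ q → term (punchIn j (punchIn p q))) - - det k Δ
      ≈⟨ +-congʳ (trans (Σ-cong term-elsewhere) (Σ-distrib-neg (λ q → Δ q q * ∂[ q , q ] (det k) Δ))) ⟩
    - Σ (λ q → Δ q q * ∂[ q , q ] (det k) Δ) - - det k Δ
      ≈⟨ solve 2 (λ a b → :- a :- :- b := :- (a :- b)) refl _ _ ⟩
    - (Σ (λ q → Δ q q * ∂[ q , q ] (det k) Δ) - det k Δ)
      ≈⟨ -‿cong (d₂≈Σ∂det k Δ) ⟨
    - d₂ k Δ ∎
    where
    j≢i = i≢j ∘ ≡.sym
    p = punchOut j≢i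
    Δ = deleteTwo i j i≢j X
    T : Fin (suc (suc k)) → Matrix (suc (suc k)) → Carrier
    T q = entry*minor q q (det (suc k))
    term : Fin (suc (suc k)) → Carrier
    term q = X q q * ∂[ j , i ] (∂[ i , j ] (det (suc k) ∘ minor q q)) X
    factor-entry : ∀ q → ∂[ j , i ] (∂[ i , j ] (T q)) X ≈ term q
    factor-entry q = trans (∂-cong (λ Y → ∂-*ˡ (diagonal-independent q i≢j))) (∂-*ˡ (diagonal-independent q j≢i))
    term-at-j : term j ≈ 0#
    term-at-j = trans (*-congˡ (∂-zero (λ Y → ∂-independent (minor-col-independent j j (det-congruent (suc k))))))
                      (zeroʳ _)
    term-at-i : term (punchIn j p) ≈ 0#
    term-at-i = trans (reflexive (≡.cong term (punchIn-punchOut j≢i)))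
                      (trans (*-congˡ (∂-zero (λ Y → ∂-independent (minor-row-independent i i (det-congruent (suc k))))))
                             (zeroʳ _))
    -- det ∘ minor r r is ∂[ r , r ] det, and ∂[ r , r ] commutes with ∂[ j , i ] ∂[ i , j ] as r ∉ {i, j}.
    term-elsewhere : ∀ q → term (punchIn j (punchIn p q)) ≈ - (Δ q q * ∂[ q , q ] (det k) Δ)
    term-elsewhere q = begin
      X r r * ∂[ j , i ] (∂[ i , j ] (det (suc k) ∘ minor r r)) X
        ≈⟨ *-congˡ (∂-cong (λ Y → ∂-cong (λ Z → sym (∂-det-diagonal (suc k) r Z)))) ⟩
      X r r * ∂[ j , i ] (∂[ i , j ] (∂[ r , r ] (det (suc (suc k))))) X
        ≈⟨ *-congˡ (trans (∂-cong (λ Y → ∂-comm (det-congruent (suc (suc k))) i≢r))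
                          (∂-comm (∂-congruent (det-congruent (suc (suc k)))) j≢r)) ⟩
      X r r * ∂[ r , r ] (∂[ j , i ] (∂[ i , j ] (det (suc (suc k))))) X
        ≈⟨ *-congˡ (trans (∂-cong (∂∂-det k i j i≢j)) ∂-neg) ⟩
      X r r * - ∂[ r , r ] (det k ∘ deleteTwo i j i≢j) X
        ≈⟨ *-congˡ (-‿cong (trans (∂-∘minor j j (det-congruent k ∘ minor-cong p p))
                                  (∂-∘minor p p (det-congruent k)))) ⟩
      X r r * - ∂[ q , q ] (det k) Δ
        ≈⟨ -‿distribʳ-* _ _ ⟨
      - (Δ q q * ∂[ q , q ] (det k) Δ) ∎
      where
      r = punchIn j (punchIn p q)
      i≢r : i ≢ r
      i≢r i≡r = punchInᵢ≢i p q (≡.sym (punchIn-injective j p (punchIn p q) (≡.trans (punchIn-punchOut j≢i) i≡r)))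
      j≢r : j ≢ r
      j≢r = punchInᵢ≢i j (punchIn p q) ∘ ≡.sym

  d₂-part : ∀ {n} → Matrix n → Fin n → Fin n → Carrier
  d₂-part {n} B i j = B i j * ∂[ i , j ] (d₂ n) B

  d₂-zeroPair-diagonal : ∀ {n} (B : Matrix n) i → d₂ n (zeroPair i i B) ≈ d₂ n B - d₂-part B i i
  d₂-zeroPair-diagonal {n} B i = begin
    d₂ n (zeroPair i i B)    ≈⟨ d₂-congruent n (λ u v → trans (zeroPair≋update i i B u v) (update-idem u v)) ⟩
    d₂ n (B [ i , i ]≔ 0#)   ≈⟨ affine-expansion (d₂-congruent n) (d₂-affine n i i) ⟩
    d₂ n B - d₂-part B i i   ∎

  d₂-zeroPair : ∀ m (B : Matrix (suc (suc m))) → (∀ s t → B s t ≈ B t s) → ∀ i j (i≢j : i ≢ j) →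
                d₂ (suc (suc m)) (zeroPair i j B) + (B i j * B i j) * d₂ m (deleteTwo i j i≢j B) ≈
                d₂ (suc (suc m)) B - (d₂-part B i j + d₂-part B j i)
  d₂-zeroPair m B B-sym i j i≢j = begin
    d₂ n (zeroPair i j B) + (B i j * B i j) * e
      ≈⟨ +-congʳ (trans (d₂-congruent n (zeroPair≋update i j B))
                        (affine-expansion₂ (d₂-congruent n) i≢j (d₂-affine n i j) (d₂-affine n j i))) ⟩
    (d₂ n B - d₂-part B i j - d₂-part B j i + (B i j * B j i) * ∂[ j , i ] (∂[ i , j ] (d₂ n)) B) + (B i j * B i j) * e
      ≈⟨ +-congʳ (+-congˡ (*-cong (*-congˡ (B-sym j i)) (∂∂-d₂ m i j i≢j B))) ⟩
    (d₂ n B - d₂-part B i j - d₂-part B j i + (B i j * B i j) * - e) + (B i j * B i j) * e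
      ≈⟨ solve 5 (λ d a b x e → (d :- a :- b :+ x :* (:- e)) :+ x :* e := d :- (a :+ b)) refl _ _ _ _ _ ⟩
    d₂ n B - (d₂-part B i j + d₂-part B j i) ∎
    where
    n = suc (suc m)
    e = d₂ m (deleteTwo i j i≢j B)

  -- Summation over i ≤ j

  when : ∀ {p} {P : Set p} → Dec P → Carrier → Carrier
  when (yes _) x = x
  when (no _)  _ = 0#

  when-yes : ∀ {p} {P : Set p} (d : Dec P) {x} → P → when d x ≈ x
  when-yes (yes _) _ = refl
  when-yes (no ¬p) p = contradiction p ¬p

  when-no : ∀ {p} {P : Set p} (d : Dec P) {x} → ¬ P → when d x ≈ 0#
  when-no (yes p) ¬p = contradiction p ¬p
  when-no (no _)  _  = refl

  when-+ : ∀ {p} {P : Set p} (d : Dec P) x y → when d (x + y) ≈ when d x + when d y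
  when-+ (yes _) x y = refl
  when-+ (no _)  x y = sym (+-identityˡ 0#)

  when-≤-suc : ∀ a b x → when (suc a ≤? suc b) x ≈ when (a ≤? b) x
  when-≤-suc a b x with a ≤? b
  ... | yes a≤b = when-yes (suc a ≤? suc b) (s≤s a≤b)
  ... | no a≰b  = when-no (suc a ≤? suc b) (a≰b ∘ s≤s⁻¹)

  when-trichotomy : ∀ {n} (i j : Fin n) x →
                    when (toℕ i <? toℕ j) x + when (i ≟ j) x + when (toℕ j <? toℕ i) x ≈ x
  when-trichotomy i j x with <-cmp i j
  ... | tri< i<j i≢j j≮i =
    trans (+-cong (+-cong (when-yes (toℕ i <? toℕ j) i<j) (when-no (i ≟ j) i≢j)) (when-no (toℕ j <? toℕ i) j≮i))
          (trans (+-identityʳ _) (+-identityʳ x))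
  ... | tri≈ i≮j i≡j j≮i =
    trans (+-cong (+-cong (when-no (toℕ i <? toℕ j) i≮j) (when-yes (i ≟ j) i≡j)) (when-no (toℕ j <? toℕ i) j≮i))
          (trans (+-identityʳ _) (+-identityˡ x))
  ... | tri> i≮j i≢j j<i =
    trans (+-cong (+-cong (when-no (toℕ i <? toℕ j) i≮j) (when-no (i ≟ j) i≢j)) (when-yes (toℕ j <? toℕ i) j<i))
          (trans (+-congʳ (+-identityˡ 0#)) (+-identityˡ x))

  Σ-upper-triangle : ∀ {n} (f : Fin n → Fin n → Carrier) →
                     Σ (λ i → Σ (λ j → when (toℕ i <? toℕ j) (f i j + f j i) + when (i ≟ j) (f i j))) ≈
                     Σ (λ i → Σ (f i))
  Σ-upper-triangle {n} f = begin
    Σ (λ i → Σ (λ j → when (toℕ i <? toℕ j) (f i j + f j i) + when (i ≟ j) (f i j)))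
      ≈⟨ ΣΣ-cong {n} split ⟩
    Σ (λ i → Σ (λ j → upper i j + transposed i j))                ≈⟨ ΣΣ-distrib-+ upper transposed ⟩
    Σ (λ i → Σ (upper i)) + Σ (λ i → Σ (transposed i))            ≈⟨ +-congˡ (Σ-comm transposed) ⟩
    Σ (λ i → Σ (upper i)) + Σ (λ i → Σ (lower i))                 ≈⟨ ΣΣ-distrib-+ upper lower ⟨
    Σ (λ i → Σ (λ j → upper i j + lower i j))
      ≈⟨ ΣΣ-cong {n} (λ i j → when-trichotomy i j (f i j)) ⟩
    Σ (λ i → Σ (f i))                                             ∎
    where
    upper lower transposed : Fin n → Fin n → Carrier
    upper i j      = when (toℕ i <? toℕ j) (f i j) + when (i ≟ j) (f i j)
    lower i j      = when (toℕ j <? toℕ i) (f i j)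
    transposed i j = when (toℕ i <? toℕ j) (f j i)
    split : ∀ i j → when (toℕ i <? toℕ j) (f i j + f j i) + when (i ≟ j) (f i j) ≈ upper i j + transposed i j
    split i j = trans (+-congʳ (when-+ (toℕ i <? toℕ j) (f i j) (f j i)))
                      (solve 3 (λ a b c → a :+ b :+ c := a :+ c :+ b) refl _ _ _)

  [1+n]C2≡n+nC2 : ∀ n → suc n C 2 ≡ n ℕ.+ n C 2
  [1+n]C2≡n+nC2 n = ≡.trans (≡.sym (nCk+nC[k+1]≡[n+1]C[k+1] n 1)) (≡.cong (ℕ._+ n C 2) (nC1≡n n))

  Σ-when-≤ : ∀ n x → Σ (λ (i : Fin n) → Σ (λ (j : Fin n) → when (toℕ i ≤? toℕ j) x)) ≈ (suc n C 2) · x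
  Σ-when-≤ zero    x = refl
  Σ-when-≤ (suc n) x = begin
    Σ {suc n} (λ _ → x) + Σ {n} (λ i → Σ {suc n} (λ j → when (suc (toℕ i) ≤? toℕ j) x))
      ≈⟨ +-cong (Σ-const (suc n) x) (trans (Σ-cong later-row) (Σ-when-≤ n x)) ⟩
    suc n · x + (suc n C 2) · x  ≈⟨ ×-homo-+ x (suc n) (suc n C 2) ⟨
    (suc n ℕ.+ suc n C 2) · x    ≡⟨ ≡.cong (_· x) ([1+n]C2≡n+nC2 (suc n)) ⟨
    (suc (suc n) C 2) · x        ∎
    where
    later-row : ∀ (i : Fin n) →
                Σ {suc n} (λ j → when (suc (toℕ i) ≤? toℕ j) x) ≈ Σ {n} (λ j → when (toℕ i ≤? toℕ j) x)
    later-row i = trans (+-identityˡ _) (Σ-cong (λ (j : Fin n) → when-≤-suc (toℕ i) (toℕ j) x))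

  summand : ∀ {n} → Matrix n → Fin n → Fin n → Carrier
  summand {n} B i j = when (toℕ i ≤? toℕ j) (d₂ n B)
                      - (when (toℕ i <? toℕ j) (d₂-part B i j + d₂-part B j i) + when (i ≟ j) (d₂-part B i j))

  -- The summands of sumLe and sumLt are local to Defs, so the type of summand≈ refers to them through
  -- a metavariable, which is solved by its use in sumLe+sumLt≈.
  mutual
    sumLe+sumLt≈ : ∀ {n} (B : Matrix n) → 2 ℕ.≤ n → (∀ s t → B s t ≈ B t s) →
                   sumLe n B + sumLt n B ≈ Σ (λ i → Σ (summand B i))
    sumLe+sumLt≈ {n} B 2≤n B-sym = trans (sym (ΣΣ-distrib-+ {n} _ _)) (ΣΣ-cong {n} (summand≈ B 2≤n B-sym))

    summand≈ : ∀ {n} (B : Matrix n) → 2 ℕ.≤ n → (∀ s t → B s t ≈ B t s) → ∀ i j → _ ≈ summand B i j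
    summand≈ {suc zero} B (s≤s ()) _ i j
    summand≈ {suc (suc m)} B _ B-sym i j with toℕ i <? toℕ j | toℕ i ≤? toℕ j | i ≟ j
    ... | yes i<j | yes _   | yes ≡.refl = contradiction i<j (ℕₚ.<-irrefl ≡.refl)
    ... | yes i<j | no i≰j  | _          = contradiction (ℕₚ.<⇒≤ i<j) i≰j
    ... | no i≮j  | yes i≤j | no i≢j     = contradiction (toℕ-injective (ℕₚ.≤-antisym i≤j (ℕₚ.≮⇒≥ i≮j))) i≢j
    ... | no _    | no i≰j  | yes ≡.refl = contradiction ℕₚ.≤-refl i≰j
    ... | no _    | no _    | no _       =
      trans (+-identityˡ 0#) (sym (trans (+-congˡ (-‿cong (+-identityˡ 0#))) (-‿inverseʳ 0#)))
    ... | no _    | yes _   | yes ≡.refl =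
      trans (+-identityʳ _) (trans (d₂-zeroPair-diagonal B i) (+-congˡ (-‿cong (sym (+-identityˡ _)))))
    ... | yes _   | yes _   | no i≢j     =
      trans (d₂-zeroPair m B B-sym i j i≢j) (+-congˡ (-‿cong (sym (+-identityʳ _))))

  ΣΣ-summand : ∀ {n} (B : Matrix n) → Σ (λ i → Σ (summand B i)) ≈ (suc n C 2) · d₂ n B - n · d₂ n B
  ΣΣ-summand {n} B = begin
    Σ (λ i → Σ (summand B i))                         ≈⟨ ΣΣ-distrib-- counted parts ⟩
    Σ (λ i → Σ (counted i)) - Σ (λ i → Σ (parts i))
      ≈⟨ +-cong (Σ-when-≤ n (d₂ n B)) (-‿cong (trans (Σ-upper-triangle (d₂-part B)) (d₂-homogeneous n B))) ⟩
    (suc n C 2) · d₂ n B - n · d₂ n B                 ∎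
    where
    counted parts : Fin n → Fin n → Carrier
    counted i j = when (toℕ i ≤? toℕ j) (d₂ n B)
    parts i j   = when (toℕ i <? toℕ j) (d₂-part B i j + d₂-part B j i) + when (i ≟ j) (d₂-part B i j)

  [1+n]C2·x-n·x≈nC2·x : ∀ n x → (suc n C 2) · x - n · x ≈ (n C 2) · x
  [1+n]C2·x-n·x≈nC2·x n x = begin
    (suc n C 2) · x - n · x      ≡⟨ ≡.cong (λ m → m · x - n · x) ([1+n]C2≡n+nC2 n) ⟩
    (n ℕ.+ n C 2) · x - n · x    ≈⟨ +-congʳ (×-homo-+ x n (n C 2)) ⟩
    n · x + (n C 2) · x - n · x  ≈⟨ xyx⁻¹≈y (n · x) ((n C 2) · x) ⟩
    (n C 2) · x                  ∎

open import Data.Nat using (_≤_; _*_; _∸_; _/_)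

[n*n∸n]/2≡nC2 : ∀ n → 2 ≤ n → (n * n ∸ n) / 2 ≡ n C 2
[n*n∸n]/2≡nC2 (suc zero)      (s≤s ())
[n*n∸n]/2≡nC2 n@(suc (suc _)) 2≤n = begin
  (n * n ∸ n) / 2          ≡⟨ ≡.cong (λ m → (n * n ∸ m) / 2) (ℕₚ.*-identityˡ n) ⟨
  (n * n ∸ 1 * n) / 2      ≡⟨ ≡.cong (_/ 2) (ℕₚ.*-distribʳ-∸ n n 1) ⟨
  ((n ∸ 1) * n) / 2        ≡⟨ ≡.cong (λ m → ((n ∸ 1) * m) / 2) (ℕₚ.*-identityʳ n) ⟨
  ((n ∸ 1) * (n * 1)) / 2  ≡⟨ nCk≡nPk/k! 2≤n ⟨
  n C 2                    ∎
  where open ≡.≡-Reasoning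

lemma2p3 : ∀ {c ℓ : Level} (R : CommutativeRing c ℓ) (n : ℕ) → 2 ≤ n →
    (B : Fin n → Fin n → CommutativeRing.Carrier R) →
    (∀ s t → CommutativeRing._≈_ R (B s t) (B t s)) →
    CommutativeRing._≈_ R
      (WithRing._·_ R ((n * n ∸ n) / 2) (WithRing.d₂ R n B))
      (CommutativeRing._+_ R (WithRing.sumLe R n B) (WithRing.sumLt R n B))
lemma2p3 R n 2≤n B B-sym = begin
  ((n * n ∸ n) / 2) · d₂ n B         ≡⟨ ≡.cong (_· d₂ n B) ([n*n∸n]/2≡nC2 n 2≤n) ⟩
  (n C 2) · d₂ n B                   ≈⟨ [1+n]C2·x-n·x≈nC2·x n (d₂ n B) ⟨
  (suc n C 2) · d₂ n B - n · d₂ n B  ≈⟨ ΣΣ-summand B ⟨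
  Σ (λ i → Σ (summand B i))          ≈⟨ sumLe+sumLt≈ B 2≤n B-sym ⟨
  sumLe n B + sumLt n B              ∎
  where
  open CommutativeRing R using (_+_; _-_; setoid)
  open WithRing R
  open Development R
  open import Relation.Binary.Reasoning.Setoid setoid
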